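{- Let $\{D_I\}$ be a family of real numbers indexed by the subsets $I\subseteq[4]=\{1,2,3,4\}$ (without repetitions) of cardinality at least $2$. There exists a weighted tree $T$ with leaf set $\{1,2,3,4\}$ in which $\{1,2\}$ and $\{3,4\}$ are cherries and such that $D_I(T)=D_I$ for all such $I$ if and only if $\{1,2\}$ and $\{3,4\}$ are pseudocherries for $\{D_I\}$ and: (A) for all $i\in\{1,2\}$, $j\in\{3,4\}$, $Z\subseteq\{1,2\}$, $Y\subseteq\{3,4\}$ and $W\subseteq[4]$ intersecting both $\{1,2\}$ and $\{3,4\}$ (for which all indices occurring below are subsets of $[4]$ of cardinality at least $2$ without repeated elements), $$-D_{i,Z}+D_{j,Z}-D_{i,Y}+D_{j,Y}=2\,(D_{j,W}-D_{i,W});$$ (B) if for $i\in\{1,2\}$ one defines $a_i=\tfrac12\big(D_{i,j}+D_{i,X}-D_{j,X}\big)$, where $j$ is the other element of $\{1,2\}$ and $X$ is any nonempty subset of $\{3,4\}$, then for $\{i,j\}=\{1,2\}$ and every nonempty $\delta\subseteq\{3,4\}$, $$D_{i,j,\delta}=a_i+D_{j,\delta}.$$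
   Context: $D_{i_1,\dots,i_k}$ denotes $D_{\{i_1,\dots,i_k\}}$, in any order; $D_{i,X}$ means $D_{\{i\}\cup X}$. A weighted tree is a finite tree each of whose edges carries a real number (weight), not necessarily positive; its leaves are labelled. For distinct leaves $i_1,\dots,i_k$, $D_{i_1,\dots,i_k}(T)$ is the sum of the weights of the edges of the minimal subtree of $T$ connecting $i_1,\dots,i_k$. A cherry in $T$ is a subtree $B$ such that exactly one of its inner vertices (the stalk) is not bivalent (does not have degree 2); the set of its leaves is then called a cherry. For the family $\{D_I\}$ and $e,e'\in[4]$, condition $\ast^{e,e'}$ means that $D_{e,X}-D_{e',X}$ does not depend on $X$ among those $X$ for which $\{e\}\cup X$ and $\{e'\}\cup X$ are indices of the family (i.e. nonempty $X\subseteq[4]\setminus\{e,e'\}$); a set $\alpha$ is a pseudocherry if $\ast^{\alpha_i,\alpha_j}$ holds for all $\alpha_i,\alpha_j\in\alpha$. -}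

module Defs where

open import Level using (_⊔_)
open import Algebra.Bundles using (CommutativeRing)
open import Data.Bool using (Bool; true; false; if_then_else_)
open import Data.Nat using (ℕ; suc; _≤_)
open import Data.Fin using (Fin; zero; suc; _≟_; #_)
open import Data.Fin.Subset using (Subset; _∈_; _∉_; _⊆_; _∪_; _∩_; ⁅_⁆; ∣_∣; Nonempty)
open import Data.Vec using (Vec; []; _∷_)
open import Data.List using (List; []; _∷_; length; filter; allFin; _++_)
open import Data.List.Relation.Unary.Unique.Propositional using (Unique)
import Data.List.Membership.Propositional as LM
open import Data.Product using (Σ; ∃; _×_; _,_)
open import Data.Sum using (_⊎_)
open import Relation.Binary.PropositionalEquality using (_≡_; _≢_)
open import Relation.Nullary using (¬_)
open import Relation.Nullary.Decidable using (¬?)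
open import Function using (_∘_)

Joins : ∀ {n m} → (Fin m → Fin n) → (Fin m → Fin n) → Fin m → Fin n → Fin n → Set
Joins src tgt e u w = (src e ≡ u × tgt e ≡ w) ⊎ (src e ≡ w × tgt e ≡ u)

data Walk {n m} (src tgt : Fin m → Fin n) : Fin n → Fin n → Set where
  []   : ∀ {u} → Walk src tgt u u
  step : ∀ {u w v} (e : Fin m) → Joins src tgt e u w → Walk src tgt w v → Walk src tgt u v

module _ {n m} {src tgt : Fin m → Fin n} where
  verts : ∀ {u v} → Walk src tgt u v → List (Fin n)
  verts {u} []           = u ∷ []
  verts {u} (step e j p) = u ∷ verts p

  edgesOf : ∀ {u v} → Walk src tgt u v → List (Fin m)
  edgesOf []           = []
  edgesOf (step e j p) = e ∷ edgesOf p

  IsPath : ∀ {u v} → Walk src tgt u v → Set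
  IsPath p = Unique (verts p)

initL : ∀ {a} {X : Set a} → List X → List X
initL []           = []
initL (x ∷ [])     = []
initL (x ∷ y ∷ xs) = x ∷ initL (y ∷ xs)

dropHead : ∀ {a} {X : Set a} → List X → List X
dropHead []       = []
dropHead (x ∷ xs) = xs

interior : ∀ {n m} {src tgt : Fin m → Fin n} {u v} → Walk src tgt u v → List (Fin n)
interior p = initL (dropHead (verts p))

degree : ∀ {n m} → (Fin m → Fin n) → (Fin m → Fin n) → Fin n → ℕ
degree {m = m} src tgt v =
  length (filter (λ e → src e ≟ v) (allFin m)) Data.Nat.+ length (filter (λ e → tgt e ≟ v) (allFin m))

-- Weighted trees with leaf set {1,2,3,4} (encoded as Fin 4 = {0,1,2,3}),
-- weights in a commutative ring R.

module _ {c ℓ} (R : CommutativeRing c ℓ) where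
  open CommutativeRing R using (_+_; _*_; -_; 0#; 1#; _≈_) renaming (Carrier to A)

  record WTree : Set c where
    field
      n m      : ℕ
      src tgt  : Fin m → Fin n
      wt       : Fin m → A
      leaf     : Fin 4 → Fin n
      -- tree: connected with exactly n - 1 edges
      connected : ∀ u v → Walk src tgt u v
      edgeCount : suc m ≡ n
      leafInj   : ∀ i j → leaf i ≡ leaf j → i ≡ j
      leafDeg   : ∀ i → degree src tgt (leaf i) ≡ 1
      degLeaf   : ∀ v → degree src tgt v ≡ 1 → ∃ λ i → leaf i ≡ v

  sumSub : ∀ {k} → Subset k → (Fin k → A) → A
  sumSub []            w = 0#
  sumSub (true  ∷ S)   w = w zero + sumSub S (w ∘ suc)
  sumSub (false ∷ S)   w = 0# + sumSub S (w ∘ suc)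

  module _ (T : WTree) where
    open WTree T

    -- edge e belongs to the minimal subtree connecting the leaves in I
    -- (= the union of the paths between leaves of I)
    InMinSubtree : Subset 4 → Fin m → Set
    InMinSubtree I e = ∃ λ i → ∃ λ i' → i ∈ I × i' ∈ I ×
      Σ (Walk src tgt (leaf i) (leaf i')) (λ p → IsPath p × LM._∈_ e (edgesOf p))

    HasDist : Subset 4 → A → Set ℓ
    HasDist I d = Σ (Subset m) λ S →
      (∀ e → (e ∈ S → InMinSubtree I e) × (InMinSubtree I e → e ∈ S)) × sumSub S wt ≈ d

    -- {a,b} is a cherry: the path between the leaves a and b has exactly one
    -- interior vertex (the stalk) which is not bivalent
    IsCherry : Fin 4 → Fin 4 → Set
    IsCherry a b = Σ (Walk src tgt (leaf a) (leaf b)) λ p →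
      IsPath p × length (filter (λ v → ¬? (degree src tgt v Data.Nat.≟ 2)) (interior p)) ≡ 1

    Realises : (Subset 4 → A) → Set ℓ
    Realises D = ∀ I → 2 ≤ ∣ I ∣ → HasDist I (D I)

  Half : Set (c ⊔ ℓ)
  Half = Σ A λ h → h + h ≈ 1#

  infixl 6 _−_
  _−_ : A → A → A
  x − y = x + - y

  P12 P34 : Subset 4
  P12 = true ∷ true ∷ false ∷ false ∷ []
  P34 = false ∷ false ∷ true ∷ true ∷ []

  module _ (D : Subset 4 → A) where
    Star : Fin 4 → Fin 4 → Set ℓ
    Star e e' = ∀ X X' → Nonempty X → Nonempty X' →
      e ∉ X → e' ∉ X → e ∉ X' → e' ∉ X' →
      D (⁅ e ⁆ ∪ X) − D (⁅ e' ⁆ ∪ X) ≈ D (⁅ e ⁆ ∪ X') − D (⁅ e' ⁆ ∪ X')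

    PseudoCherry : Subset 4 → Set ℓ
    PseudoCherry α = ∀ e e' → e ∈ α → e' ∈ α → Star e e'

    Admissible : Fin 4 → Subset 4 → Set
    Admissible i X = i ∉ X × 2 ≤ ∣ ⁅ i ⁆ ∪ X ∣

    CondA : Set ℓ
    CondA = ∀ i j Z Y W → i ∈ P12 → j ∈ P34 → Z ⊆ P12 → Y ⊆ P34 →
      Nonempty (W ∩ P12) → Nonempty (W ∩ P34) →
      Admissible i Z → Admissible j Z → Admissible i Y → Admissible j Y →
      Admissible j W → Admissible i W →
      - D (⁅ i ⁆ ∪ Z) + D (⁅ j ⁆ ∪ Z) − D (⁅ i ⁆ ∪ Y) + D (⁅ j ⁆ ∪ Y)
        ≈ (1# + 1#) * (D (⁅ j ⁆ ∪ W) − D (⁅ i ⁆ ∪ W))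

    aOf : Half → Fin 4 → Fin 4 → Subset 4 → A
    aOf (h , _) i j X = h * (D (⁅ i ⁆ ∪ ⁅ j ⁆) + D (⁅ i ⁆ ∪ X) − D (⁅ j ⁆ ∪ X))

    CondB : Half → Set ℓ
    CondB h = ∀ i j → i ∈ P12 → j ∈ P12 → i ≢ j →
      ∀ X δ → X ⊆ P34 → Nonempty X → δ ⊆ P34 → Nonempty δ →
      D (⁅ i ⁆ ∪ ⁅ j ⁆ ∪ δ) ≈ aOf h i j X + D (⁅ j ⁆ ∪ δ)

module Submission where

-- Each edge of a tree splits the leaves into its two sides, and D_I(T) is the
-- total weight of the edges whose split separates I. When {0,1} is a cherry
-- no edge separates both {0,1} and {2,3}; so a linear identity
-- Σ_{I ∈ Is} D_I = Σ_{J ∈ Js} D_J holds in every such tree as soon as each of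
-- the finitely many compatible splits separates as many sets of Is as of Js.
-- The pseudocherry conditions, (A) and (B) are families of such identities,
-- checked by evaluation: this is the forward direction. Conversely, the
-- quartet tree with pendant weights a_i and inner weight D_{02} − a_0 − a_2
-- agrees with D on pairs; it satisfies (A) and (B) by the forward direction,
-- and (A), (B) determine a family from its pairs, so it realises D.

open import Defs hiding (_−_)
open import Algebra.Bundles using (CommutativeRing)
open import Data.Nat as ℕ using (ℕ; zero; suc; _≤_; z≤n; s≤s)
import Data.Nat.Properties as ℕP
open import Data.Integer as ℤ using (ℤ; +_; -[1+_]; _⊖_)
import Data.Integer.Properties as ℤP
open import Data.Sign as Sign using (Sign)
open import Data.Maybe using (Maybe; just; nothing)
open import Data.Bool using (Bool; true; false; if_then_else_)
open import Data.Fin as Fin using (Fin; zero; suc; #_; punchIn; punchOut; _≟_)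
import Data.Fin.Properties as FinP
open import Data.Fin.Subset using (Subset; _∈_; _∉_; _⊆_; _∪_; _∩_; ∁; ⁅_⁆; ∣_∣; Nonempty; inside; outside)
import Data.Fin.Subset.Properties as SubsetP
open import Data.Vec as Vec using ([]; _∷_; lookup; tabulate)
import Data.Vec.Properties as VecP
open import Data.List as List using (List; []; _∷_; _++_; length; filter)
import Data.List.Properties as ListP
open import Data.List.Relation.Unary.Any using (here; there)
open import Data.List.Relation.Unary.All as All using (All; []; _∷_)
import Data.List.Relation.Unary.All.Properties as AllP
open import Data.List.Relation.Unary.AllPairs using ([]; _∷_)
open import Data.List.Relation.Unary.Unique.Propositional using (Unique)
import Data.List.Relation.Unary.Unique.Propositional.Properties as UniqueP
open import Data.List.Membership.Propositional using () renaming (_∈_ to _∈ₗ_; _∉_ to _∉ₗ_)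
open import Data.List.Membership.Propositional.Properties using (∈-filter⁺; ∈-allFin; ∈-++⁺ˡ; ∈-++⁺ʳ)
import Data.List.Membership.DecPropositional as DecMembership
open import Data.Product using (Σ; ∃; _×_; _,_; proj₁; proj₂)
open import Data.Sum using (_⊎_; inj₁; inj₂; [_,_]′)
open import Data.Empty using (⊥; ⊥-elim)
open import Function using (_∘_)
open import Function.Bundles using (_⇔_; mk⇔)
open import Relation.Binary.PropositionalEquality as P using (_≡_; _≢_)
import Relation.Binary.Reasoning.Setoid
open import Relation.Nullary using (Dec; yes; no; does; ¬_)
open import Relation.Nullary.Decidable using (True; map′; _×-dec_; _→-dec_; ¬?; toWitness; dec-true)
open import Relation.Unary using (Decidable)
import Algebra.Solver.Ring.AlmostCommutativeRing as ACR

-- The canonical map ℤ → R is a ring morphism; with it the standard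
-- library's ring solver (which needs coefficients with decidable
-- equality) normalises polynomial identities in any commutative ring.

module IntegerCoefficients {c ℓ} (R : CommutativeRing c ℓ) where
  open CommutativeRing R
  open import Algebra.Properties.Semiring.Mult.TCOptimised semiring using (×-homo-+; ×1-homo-*; 1+×) renaming (_×_ to _·_)
  open import Algebra.Properties.Ring ring using (-‿distribˡ-*; -‿distribʳ-*)
  open import Algebra.Properties.Group +-group using (⁻¹-involutive; ε⁻¹≈ε)
  open import Algebra.Properties.AbelianGroup +-abelianGroup using (⁻¹-∙-comm)
  open import Algebra.Properties.CommutativeSemigroup +-commutativeSemigroup using (interchange)
  open import Relation.Binary.Reasoning.Setoid setoid

  -- (uses the multiplication with 1 · x = x, so that 1 and 0 map to 1# and 0#)
  fromℕ : ℕ → Carrier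
  fromℕ n = n · 1#

  fromℤ : ℤ → Carrier
  fromℤ (+ n)    = fromℕ n
  fromℤ -[1+ n ] = - fromℕ (suc n)

  fromℤ-⊖ : ∀ m n → fromℤ (m ⊖ n) ≈ fromℕ m + - fromℕ n
  fromℤ-⊖ m       zero    = sym (trans (+-congˡ ε⁻¹≈ε) (+-identityʳ _))
  fromℤ-⊖ zero    (suc n) = sym (+-identityˡ _)
  fromℤ-⊖ (suc m) (suc n) = begin
    fromℤ (suc m ⊖ suc n)                   ≡⟨ P.cong fromℤ (ℤP.[1+m]⊖[1+n]≡m⊖n m n) ⟩
    fromℤ (m ⊖ n)                           ≈⟨ fromℤ-⊖ m n ⟩
    fromℕ m + - fromℕ n                     ≈⟨ sym (+-identityˡ _) ⟩
    0# + (fromℕ m + - fromℕ n)              ≈⟨ +-congʳ (sym (-‿inverseʳ 1#)) ⟩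
    (1# + - 1#) + (fromℕ m + - fromℕ n)     ≈⟨ interchange _ _ _ _ ⟩
    (1# + fromℕ m) + (- 1# + - fromℕ n)     ≈⟨ +-congˡ (⁻¹-∙-comm _ _) ⟩
    (1# + fromℕ m) + - (1# + fromℕ n)       ≈⟨ +-cong (sym (1+× m 1#)) (-‿cong (sym (1+× n 1#))) ⟩
    fromℕ (suc m) + - fromℕ (suc n)         ∎

  fromℤ-+ : ∀ i j → fromℤ (i ℤ.+ j) ≈ fromℤ i + fromℤ j
  fromℤ-+ (+ m)    (+ n)    = ×-homo-+ 1# m n
  fromℤ-+ (+ m)    -[1+ n ] = fromℤ-⊖ m (suc n)
  fromℤ-+ -[1+ m ] (+ n)    = trans (fromℤ-⊖ n (suc m)) (+-comm _ _)
  fromℤ-+ -[1+ m ] -[1+ n ] = begin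
    - fromℕ (suc (suc (m ℕ.+ n)))        ≡⟨ P.cong (λ k → - fromℕ (suc k)) (P.sym (ℕP.+-suc m n)) ⟩
    - fromℕ (suc m ℕ.+ suc n)            ≈⟨ -‿cong (×-homo-+ 1# (suc m) (suc n)) ⟩
    - (fromℕ (suc m) + fromℕ (suc n))    ≈⟨ sym (⁻¹-∙-comm _ _) ⟩
    - fromℕ (suc m) + - fromℕ (suc n)    ∎

  fromℤ-neg : ∀ i → fromℤ (ℤ.- i) ≈ - fromℤ i
  fromℤ-neg -[1+ n ]      = sym (⁻¹-involutive _)
  fromℤ-neg (+ zero)      = sym ε⁻¹≈ε
  fromℤ-neg (+ suc n)     = refl

  -- signed naturals, the shape in which ℤ multiplication is defined
  signed : Sign → Carrier → Carrier
  signed Sign.+ x = x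
  signed Sign.- x = - x

  signed-cong : ∀ s {x y} → x ≈ y → signed s x ≈ signed s y
  signed-cong Sign.+ p = p
  signed-cong Sign.- p = -‿cong p

  fromℤ-◃ : ∀ s n → fromℤ (s ℤ.◃ n) ≈ signed s (fromℕ n)
  fromℤ-◃ Sign.+ zero    = refl
  fromℤ-◃ Sign.- zero    = sym ε⁻¹≈ε
  fromℤ-◃ Sign.+ (suc n) = refl
  fromℤ-◃ Sign.- (suc n) = refl

  fromℤ-signAbs : ∀ i → fromℤ i ≈ signed (ℤ.sign i) (fromℕ (ℤ.∣_∣ i))
  fromℤ-signAbs (+ n)    = refl
  fromℤ-signAbs -[1+ n ] = refl

  signed-* : ∀ s t x y → signed (s Sign.* t) (x * y) ≈ signed s x * signed t y
  signed-* Sign.+ Sign.+ x y = refl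
  signed-* Sign.+ Sign.- x y = -‿distribʳ-* x y
  signed-* Sign.- Sign.+ x y = -‿distribˡ-* x y
  signed-* Sign.- Sign.- x y =
    trans (sym (⁻¹-involutive _)) (trans (-‿cong (-‿distribˡ-* x y)) (-‿distribʳ-* (- x) y))

  fromℤ-* : ∀ i j → fromℤ (i ℤ.* j) ≈ fromℤ i * fromℤ j
  fromℤ-* i j = begin
    fromℤ (i ℤ.* j)                                            ≈⟨ fromℤ-◃ (sign i Sign.* sign j) (abs i ℕ.* abs j) ⟩
    signed (sign i Sign.* sign j) (fromℕ (abs i ℕ.* abs j))    ≈⟨ signed-cong (sign i Sign.* sign j) (×1-homo-* (abs i) (abs j)) ⟩
    signed (sign i Sign.* sign j) (fromℕ (abs i) * fromℕ (abs j))  ≈⟨ signed-* (sign i) (sign j) _ _ ⟩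
    signed (sign i) (fromℕ (abs i)) * signed (sign j) (fromℕ (abs j)) ≈⟨ *-cong (sym (fromℤ-signAbs i)) (sym (fromℤ-signAbs j)) ⟩
    fromℤ i * fromℤ j                                          ∎
    where open import Data.Integer using (sign) renaming (∣_∣ to abs)

  almostCommutativeRing : ACR.AlmostCommutativeRing c ℓ
  almostCommutativeRing = ACR.fromCommutativeRing R

  fromℤ-morphism : ℤ.+-*-rawRing ACR.-Raw-AlmostCommutative⟶ almostCommutativeRing
  fromℤ-morphism = record
    { ⟦_⟧ = fromℤ ; +-homo = fromℤ-+ ; *-homo = fromℤ-* ; -‿homo = fromℤ-neg
    ; 0-homo = refl ; 1-homo = refl }

  -- a sound (incomplete) equality test on coefficients, as the solver requires
  coefficient≟ : ∀ i j → Maybe (fromℤ i ≈ fromℤ j)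
  coefficient≟ i j with i ℤ.≟ j
  ... | yes P.refl = just refl
  ... | no _       = nothing

  open import Algebra.Solver.Ring ℤ.+-*-rawRing almostCommutativeRing fromℤ-morphism coefficient≟ public

module RingFacts {c ℓ} (R : CommutativeRing c ℓ) where
  open CommutativeRing R
  open IntegerCoefficients R using (solve; _:+_; _:*_; :-_; _:-_; _:=_; con)
  open import Relation.Binary.Reasoning.Setoid setoid

  infixl 6 _−_
  _−_ : Carrier → Carrier → Carrier
  x − y = x + - y

  two : Carrier
  two = 1# + 1#

  difference-zero : ∀ {x y} → x ≈ y → x − y ≈ 0#
  difference-zero {x} {y} x≈y = trans (+-congʳ x≈y) (-‿inverseʳ y)

  from-difference : ∀ {x y} → x − y ≈ 0# → x ≈ y
  from-difference {x} {y} x−y≈0 = begin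
    x             ≈⟨ solve 2 (λ x y → x := (x :- y) :+ y) refl x y ⟩
    (x − y) + y   ≈⟨ +-congʳ x−y≈0 ⟩
    0# + y        ≈⟨ +-identityˡ y ⟩
    y             ∎

  -- a + d = c + b, read as an equality of differences (the shape of *^{e,e'})
  exchange : ∀ a b c d → a + (d + 0#) ≈ c + (b + 0#) → a − b ≈ c − d
  exchange a b c d eq = from-difference (begin
    (a − b) − (c − d)
      ≈⟨ solve 4 (λ a b c d → (a :- b) :- (c :- d) := (a :+ (d :+ con (+ 0))) :- (c :+ (b :+ con (+ 0)))) refl a b c d ⟩
    (a + (d + 0#)) − (c + (b + 0#))   ≈⟨ difference-zero eq ⟩
    0#                                ∎)

  -- the shape of condition (A)
  doubled-difference : ∀ a b c e f g → b + (e + (g + (g + 0#))) ≈ a + (c + (f + (f + 0#))) →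
    - a + b − c + e ≈ two * (f − g)
  doubled-difference a b c e f g eq = from-difference (begin
    (- a + b − c + e) − two * (f − g)
      ≈⟨ solve 6 (λ a b c e f g → (:- a :+ b :- c :+ e) :- ((con (+ 1) :+ con (+ 1)) :* (f :- g))
                   := (b :+ (e :+ (g :+ (g :+ con (+ 0))))) :- (a :+ (c :+ (f :+ (f :+ con (+ 0))))))
           refl a b c e f g ⟩
    (b + (e + (g + (g + 0#)))) − (a + (c + (f + (f + 0#))))   ≈⟨ difference-zero eq ⟩
    0#                                                        ∎)

  difference-injective : ∀ {x y x′ y′} → x − y ≈ x′ − y′ → y ≈ y′ → x ≈ x′
  difference-injective {x} {y} {x′} {y′} eq y≈y′ = from-difference (begin
    x − x′                        ≈⟨ solve 4 (λ x y x′ y′ → x :- x′ := ((x :- y) :- (x′ :- y′)) :+ (y :- y′)) refl x y x′ y′ ⟩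
    ((x − y) − (x′ − y′)) + (y − y′) ≈⟨ +-cong (difference-zero eq) (difference-zero y≈y′) ⟩
    0# + 0#                       ≈⟨ +-identityˡ 0# ⟩
    0#                            ∎)

  module Halving (h : Carrier) (h+h≈1 : h + h ≈ 1#) where

    vanishes : ∀ k → ((h + h) − 1#) * k ≈ 0#
    vanishes k = trans (*-congʳ (difference-zero h+h≈1)) (zeroˡ k)

    -- the shape of condition (B)
    halved-difference : ∀ x y z w t → x + (y + (z + (z + 0#))) ≈ w + (t + (t + 0#)) →
      t ≈ h * (x + y − w) + z
    halved-difference x y z w t eq = from-difference (begin
      t − (h * (x + y − w) + z)
        ≈⟨ solve 6 (λ h x y z w t → t :- (h :* (x :+ y :- w) :+ z)
                     := h :* ((w :+ (t :+ (t :+ con (+ 0)))) :- (x :+ (y :+ (z :+ (z :+ con (+ 0))))))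
                        :- ((h :+ h) :- con (+ 1)) :* (t :- z))
             refl h x y z w t ⟩
      h * ((w + (t + (t + 0#))) − (x + (y + (z + (z + 0#))))) − ((h + h) − 1#) * (t − z)
        ≈⟨ +-cong (*-congˡ (difference-zero (sym eq))) (-‿cong (vanishes (t − z))) ⟩
      h * 0# − 0#     ≈⟨ solve 1 (λ h → h :* con (+ 0) :- con (+ 0) := con (+ 0)) refl h ⟩
      0#              ∎)

    cancel-two : ∀ {x y} → two * x ≈ two * y → x ≈ y
    cancel-two {x} {y} eq = begin
      x               ≈⟨ halve x ⟨
      h * (two * x)   ≈⟨ *-congˡ eq ⟩
      h * (two * y)   ≈⟨ halve y ⟩
      y               ∎
      where
      halve : ∀ z → h * (two * z) ≈ z
      halve z = from-difference (trans
        (solve 2 (λ h z → h :* ((con (+ 1) :+ con (+ 1)) :* z) :- z := ((h :+ h) :- con (+ 1)) :* z) refl h z)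
        (vanishes z))

    -- the two pendant weights a_i, a_j of a cherry add up to D_{ij}
    recombine : ∀ x y z → h * (x + y − z) + h * (x + z − y) ≈ x
    recombine x y z = from-difference (trans
      (solve 4 (λ h x y z → h :* (x :+ y :- z) :+ h :* (x :+ z :- y) :- x := ((h :+ h) :- con (+ 1)) :* x)
         refl h x y z)
      (vanishes x))

    -- ... and differ by D_{iX} − D_{jX}
    separate : ∀ x y z → h * (x + z − y) − h * (x + y − z) ≈ z − y
    separate x y z = from-difference (trans
      (solve 4 (λ h x y z → h :* (x :+ z :- y) :- h :* (x :+ y :- z) :- (z :- y) := ((h :+ h) :- con (+ 1)) :* (z :- y))
         refl h x y z)
      (vanishes (z − y)))

module Walks {n m : ℕ} (src tgt : Fin m → Fin n) where
  open P using (refl; sym; cong)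
  open DecMembership (_≟_ {n}) using (_∈?_)

  infix 4 _⇝_
  _⇝_ : Fin n → Fin n → Set
  _⇝_ = Walk src tgt

  infixr 5 _▹_
  _▹_ : ∀ {x y z} → x ⇝ y → y ⇝ z → x ⇝ z
  []           ▹ q = q
  step e j p   ▹ q = step e j (p ▹ q)

  joins-sym : ∀ {e u w} → Joins src tgt e u w → Joins src tgt e w u
  joins-sym (inj₁ (a , b)) = inj₂ (a , b)
  joins-sym (inj₂ (a , b)) = inj₁ (a , b)

  reverse : ∀ {x y} → x ⇝ y → y ⇝ x
  reverse []           = []
  reverse (step e j p) = reverse p ▹ step e (joins-sym j) []

  edges-▹ : ∀ {x y z} (p : x ⇝ y) (q : y ⇝ z) {f} → f ∈ₗ edgesOf (p ▹ q) → f ∈ₗ edgesOf p ⊎ f ∈ₗ edgesOf q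
  edges-▹ []           q f∈       = inj₂ f∈
  edges-▹ (step e j p) q (here r) = inj₁ (here r)
  edges-▹ (step e j p) q (there f∈) with edges-▹ p q f∈
  ... | inj₁ f∈p = inj₁ (there f∈p)
  ... | inj₂ f∈q = inj₂ f∈q

  edges-▹ʳ : ∀ {x y z} (p : x ⇝ y) (q : y ⇝ z) {f} → f ∈ₗ edgesOf q → f ∈ₗ edgesOf (p ▹ q)
  edges-▹ʳ []           q f∈ = f∈
  edges-▹ʳ (step e j p) q f∈ = there (edges-▹ʳ p q f∈)

  edges-reverse : ∀ {x y} (p : x ⇝ y) {f} → f ∈ₗ edgesOf (reverse p) → f ∈ₗ edgesOf p
  edges-reverse (step e j p) f∈ with edges-▹ (reverse p) (step e (joins-sym j) []) f∈
  ... | inj₁ f∈p      = there (edges-reverse p f∈p)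
  ... | inj₂ (here r) = here r

  Avoids : Fin m → ∀ {x y} → x ⇝ y → Set
  Avoids e p = e ∉ₗ edgesOf p

  avoids-▹ : ∀ {e x y z} (p : x ⇝ y) (q : y ⇝ z) → Avoids e p → Avoids e q → Avoids e (p ▹ q)
  avoids-▹ p q ap aq e∈ = [ ap , aq ]′ (edges-▹ p q e∈)

  avoids-reverse : ∀ {e x y} (p : x ⇝ y) → Avoids e p → Avoids e (reverse p)
  avoids-reverse p ap = ap ∘ edges-reverse p

  ends-visited : ∀ {x y} (p : x ⇝ y) {f} → f ∈ₗ edgesOf p → src f ∈ₗ verts p × tgt f ∈ₗ verts p
  ends-visited (step e j p) (there f∈) with ends-visited p f∈
  ... | s∈ , t∈ = there s∈ , there t∈
  ends-visited (step e (inj₁ (s≡ , t≡)) p) (here refl) = here s≡ , there (start-visited p t≡)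
    where
    start-visited : ∀ {w y} (p : w ⇝ y) → tgt e ≡ w → tgt e ∈ₗ verts p
    start-visited []           r = here r
    start-visited (step _ _ _) r = here r
  ends-visited (step e (inj₂ (s≡ , t≡)) p) (here refl) = there (start-visited p s≡) , here t≡
    where
    start-visited : ∀ {w y} (p : w ⇝ y) → src e ≡ w → src e ∈ₗ verts p
    start-visited []           r = here r
    start-visited (step _ _ _) r = here r

  initialVerts : ∀ {x y} → x ⇝ y → List (Fin n)
  initialVerts []               = []
  initialVerts {x} (step e j p) = x ∷ initialVerts p

  verts-▹ : ∀ {x y z} (p : x ⇝ y) (q : y ⇝ z) → verts (p ▹ q) ≡ initialVerts p ++ verts q
  verts-▹ []           q = refl
  verts-▹ (step e j p) q = cong (_ ∷_) (verts-▹ p q)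

  verts-initialVerts : ∀ {x y} (p : x ⇝ y) → verts p ≡ initialVerts p ++ (y ∷ [])
  verts-initialVerts []           = refl
  verts-initialVerts (step e j p) = cong (_ ∷_) (verts-initialVerts p)

  suffixFrom : ∀ {x w y} (q : w ⇝ y) → x ∈ₗ verts q →
    ∃ λ (r : x ⇝ y) → (Unique (verts q) → Unique (verts r)) × (∀ {f} → f ∈ₗ edgesOf r → f ∈ₗ edgesOf q)
  suffixFrom []           (here refl) = [] , (λ u → u) , (λ f∈ → f∈)
  suffixFrom (step f j q) (here refl) = step f j q , (λ u → u) , (λ f∈ → f∈)
  suffixFrom (step f j q) (there x∈) with suffixFrom q x∈
  ... | r , uniq , sub = r , (λ { (_ ∷ u) → uniq u }) , (λ f∈ → there (sub f∈))

  toPath : ∀ {x y} (p : x ⇝ y) → ∃ λ (q : x ⇝ y) → Unique (verts q) × (∀ {f} → f ∈ₗ edgesOf q → f ∈ₗ edgesOf p)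
  toPath [] = [] , ([] ∷ []) , (λ ())
  toPath {x} (step f j p) = extend (toPath p) (x ∈? verts (proj₁ (toPath p)))
    where
    extend : (r : ∃ λ q → Unique (verts q) × (∀ {g} → g ∈ₗ edgesOf q → g ∈ₗ edgesOf p)) →
      Dec (x ∈ₗ verts (proj₁ r)) →
      ∃ λ q → Unique (verts q) × (∀ {g} → g ∈ₗ edgesOf q → g ∈ₗ edgesOf (step f j p))
    extend (q , uq , sub) (yes x∈) with suffixFrom q x∈
    ... | r , uniq , sub′ = r , uniq uq , (λ g∈ → there (sub (sub′ g∈)))
    extend (q , uq , sub) (no x∉) =
      step f j q , (AllP.¬Any⇒All¬ _ x∉ ∷ uq) , λ { (here r) → here r ; (there g∈) → there (sub g∈) }

-- Induction on k: a loop can be dropped; otherwise the ends a, b of the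
-- first edge are merged, which keeps the rest of the graph connected.

module EdgeBound where
  open P using (refl; sym; trans; cong; subst)

  no-walk-without-edges : ∀ {n} {s t : Fin 0 → Fin (suc (suc n))} → Walk s t zero (suc zero) → ⊥
  no-walk-without-edges (step () _ _)

  drop-loop : ∀ {n k} {s t : Fin (suc k) → Fin n} → s zero ≡ t zero →
    ∀ {u v} → Walk s t u v → Walk (s ∘ suc) (t ∘ suc) u v
  drop-loop loop []                             = []
  drop-loop loop (step zero (inj₁ (a , b)) p)   = subst (λ z → Walk _ _ z _) (trans (sym b) (trans (sym loop) a)) (drop-loop loop p)
  drop-loop loop (step zero (inj₂ (a , b)) p)   = subst (λ z → Walk _ _ z _) (trans (sym a) (trans loop b)) (drop-loop loop p)
  drop-loop loop (step (suc e) j p)             = step e j (drop-loop loop p)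

  module Contract {n k} (s t : Fin (suc k) → Fin (suc n)) (a≢b : s zero ≢ t zero) where
    a b : Fin (suc n)
    a = s zero
    b = t zero

    -- identify b with a, renumbering the remaining vertices
    merge : Fin (suc n) → Fin n
    merge x with x ≟ b
    ... | yes _   = punchOut {i = b} {j = a} (a≢b ∘ sym)
    ... | no x≢b  = punchOut {i = b} {j = x} (x≢b ∘ sym)

    merge-ab : merge a ≡ merge b
    merge-ab with a ≟ b | b ≟ b
    ... | yes a≡b | _      = ⊥-elim (a≢b a≡b)
    ... | no _    | yes _  = FinP.punchOut-cong b refl
    ... | no _    | no b≢b = ⊥-elim (b≢b refl)

    merge-punchIn : ∀ x → merge (punchIn b x) ≡ x
    merge-punchIn x with punchIn b x ≟ b
    ... | yes r = ⊥-elim (FinP.punchInᵢ≢i b x r)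
    ... | no _  = trans (FinP.punchOut-cong b refl) (FinP.punchOut-punchIn b)

    s′ t′ : Fin k → Fin n
    s′ = merge ∘ s ∘ suc
    t′ = merge ∘ t ∘ suc

    merge-walk : ∀ {u v} → Walk s t u v → Walk s′ t′ (merge u) (merge v)
    merge-walk [] = []
    merge-walk (step zero (inj₁ (p , q)) w) =
      subst (λ z → Walk s′ t′ z _) (trans (cong merge (sym q)) (trans (sym merge-ab) (cong merge p))) (merge-walk w)
    merge-walk (step zero (inj₂ (p , q)) w) =
      subst (λ z → Walk s′ t′ z _) (trans (cong merge (sym p)) (trans merge-ab (cong merge q))) (merge-walk w)
    merge-walk (step (suc e) (inj₁ (p , q)) w) = step e (inj₁ (cong merge p , cong merge q)) (merge-walk w)
    merge-walk (step (suc e) (inj₂ (p , q)) w) = step e (inj₂ (cong merge p , cong merge q)) (merge-walk w)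

    merged-connected : (∀ u v → Walk s t u v) → ∀ x y → Walk s′ t′ x y
    merged-connected conn x y =
      P.subst₂ (Walk s′ t′) (merge-punchIn x) (merge-punchIn y) (merge-walk (conn (punchIn b x) (punchIn b y)))

  vertex-bound : ∀ {n k} (s t : Fin k → Fin n) → (∀ u v → Walk s t u v) → n ≤ suc k
  vertex-bound {zero}          s t conn = z≤n
  vertex-bound {suc zero}      s t conn = s≤s z≤n
  vertex-bound {suc (suc n)} {zero} s t conn = ⊥-elim (no-walk-without-edges (conn zero (suc zero)))
  vertex-bound {suc n} {suc k} s t conn with s zero ≟ t zero
  ... | yes loop = ℕP.≤-trans (vertex-bound (s ∘ suc) (t ∘ suc) (λ u v → drop-loop loop (conn u v))) (ℕP.n≤1+n _)
  ... | no a≢b   = s≤s (vertex-bound (Contract.s′ s t a≢b) (Contract.t′ s t a≢b) (Contract.merged-connected s t a≢b conn))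

-- Trees (connected, m edges, m + 1 vertices): no edge lies on a cycle,
-- so each edge e = {u, v} splits the vertices into the u-side and the v-side.

module Tree {n m : ℕ} (src tgt : Fin m → Fin n) (conn : ∀ u v → Walk src tgt u v) (count : suc m ≡ n) where
  open P using (refl; sym; trans; cong; subst)
  open Walks src tgt

  -- removing an edge disconnects a tree: otherwise the remaining m - 1 edges
  -- would connect all m + 1 vertices, contradicting the vertex bound
  acyclic : ∀ (e : Fin m) (q : src e ⇝ tgt e) → Avoids e q → ⊥
  acyclic = go m src tgt conn count
    where
    go : ∀ m (src tgt : Fin m → Fin n) (conn : ∀ u v → Walk src tgt u v) → suc m ≡ n →
         ∀ (e : Fin m) (q : Walk src tgt (src e) (tgt e)) → e ∉ₗ edgesOf q → ⊥
    go zero     src tgt conn cnt () q aq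
    go (suc m′) src tgt conn cnt e q aq =
      ℕP.<-irrefl refl (subst (λ z → z ≤ suc m′) (sym cnt) (EdgeBound.vertex-bound s′ t′ conn′))
      where
      open Walks src tgt using () renaming (_▹_ to _▹′_; reverse to reverse′; avoids-▹ to avoids-▹′; avoids-reverse to avoids-reverse′)
      s′ t′ : Fin m′ → Fin n
      s′ = src ∘ punchIn e
      t′ = tgt ∘ punchIn e
      without-e : ∀ {u v} (p : Walk src tgt u v) → e ∉ₗ edgesOf p → Walk s′ t′ u v
      without-e []           a = []
      without-e (step f j p) a =
        step (punchOut e≢f) (subst (λ g → Joins src tgt g _ _) (sym (FinP.punchIn-punchOut e≢f)) j) (without-e p (a ∘ there))
        where
        e≢f : e ≢ f
        e≢f r = a (here r)
      edges-subst : ∀ {x y z} (r : x ≡ y) (w : Walk src tgt x z) → edgesOf (subst (λ z → Walk src tgt z _) r w) ≡ edgesOf w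
      edges-subst refl w = refl
      -- every use of e in a walk can be replaced by the detour q
      detour : ∀ {u v} (p : Walk src tgt u v) → ∃ λ (r : Walk src tgt u v) → e ∉ₗ edgesOf r
      detour [] = [] , λ ()
      detour (step f j p) with f ≟ e | detour p
      ... | no f≢e | r , ar = step f j r , λ { (here x) → f≢e (sym x) ; (there i) → ar i }
      detour (step f (inj₁ (a , b)) p) | yes refl | r , ar =
        subst (λ z → Walk src tgt z _) a (q ▹′ subst (λ z → Walk src tgt z _) (sym b) r) ,
        λ i → avoids-▹′ q _ aq (λ k → ar (subst (e ∈ₗ_) (edges-subst (sym b) r) k)) (subst (e ∈ₗ_) (edges-subst a _) i)
      detour (step f (inj₂ (a , b)) p) | yes refl | r , ar =
        subst (λ z → Walk src tgt z _) b (reverse′ q ▹′ subst (λ z → Walk src tgt z _) (sym a) r) ,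
        λ i → avoids-▹′ (reverse′ q) _ (avoids-reverse′ q aq) (λ k → ar (subst (e ∈ₗ_) (edges-subst (sym a) r) k))
                (subst (e ∈ₗ_) (edges-subst b _) i)
      conn′ : ∀ u v → Walk s′ t′ u v
      conn′ u v = without-e (proj₁ (detour (conn u v))) (proj₂ (detour (conn u v)))

  module Side (e : Fin m) where
    u v : Fin n
    u = src e
    v = tgt e

    infix 4 _~_
    _~_ : Fin n → Fin n → Set
    x ~ y = ∃ λ (p : x ⇝ y) → Avoids e p

    ~-refl : ∀ {x} → x ~ x
    ~-refl = [] , λ ()

    ~-reflexive : ∀ {x y} → x ≡ y → x ~ y
    ~-reflexive refl = ~-refl

    ~-sym : ∀ {x y} → x ~ y → y ~ x
    ~-sym (p , a) = reverse p , avoids-reverse p a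

    ~-trans : ∀ {x y z} → x ~ y → y ~ z → x ~ z
    ~-trans (p , a) (q , b) = p ▹ q , avoids-▹ p q a b

    ~-step : ∀ {x w y} f → f ≢ e → Joins src tgt f x w → w ~ y → x ~ y
    ~-step f f≢e j (p , a) = step f j p , λ { (here r) → f≢e (sym r) ; (there k) → a k }

    u≁v : ¬ (u ~ v)
    u≁v (p , a) = acyclic e p a

    not-both-sides : ∀ {x} → x ~ u → x ~ v → ⊥
    not-both-sides x~u x~v = u≁v (~-trans (~-sym x~u) x~v)

    -- following a walk until it first uses e
    side-of-walk : ∀ {x y} (p : x ⇝ y) → x ~ y ⊎ (x ~ u ⊎ x ~ v)
    side-of-walk [] = inj₁ ~-refl
    side-of-walk (step f j p) with f ≟ e
    side-of-walk (step f (inj₁ (a , b)) p) | yes refl = inj₂ (inj₁ (~-reflexive (sym a)))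
    side-of-walk (step f (inj₂ (a , b)) p) | yes refl = inj₂ (inj₂ (~-reflexive (sym b)))
    ... | no f≢e with side-of-walk p
    ... | inj₁ r        = inj₁ (~-step f f≢e j r)
    ... | inj₂ (inj₁ r) = inj₂ (inj₁ (~-step f f≢e j r))
    ... | inj₂ (inj₂ r) = inj₂ (inj₂ (~-step f f≢e j r))

    side : ∀ x → x ~ u ⊎ x ~ v
    side x with side-of-walk (conn x u)
    ... | inj₁ r = inj₁ r
    ... | inj₂ r = r

    ~-along : ∀ {x y z} (p : x ⇝ y) → Avoids e p → z ∈ₗ verts p → x ~ z × z ~ y
    ~-along []           a (here refl) = ~-refl , ~-refl
    ~-along (step f j p) a (here refl) = ~-refl , (step f j p , a)
    ~-along (step f j p) a (there i) with ~-along p (a ∘ there) i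
    ... | r , s = ~-step f (λ q → a (here (sym q))) j r , s

    path-crosses : ∀ {a b} (p : a ⇝ b) → Unique (verts p) → e ∈ₗ edgesOf p →
      (a ~ u × v ~ b) ⊎ (a ~ v × u ~ b)
    path-crosses (step f j p) up i with f ≟ e
    path-crosses (step f (inj₁ (a , b)) p) (ua ∷ up) i | yes refl =
      inj₁ (~-reflexive (sym a) , subst (_~ _) (sym b) (p , λ k → All.lookup ua (proj₁ (ends-visited p k)) (sym a)))
    path-crosses (step f (inj₂ (a , b)) p) (ua ∷ up) i | yes refl =
      inj₂ (~-reflexive (sym b) , subst (_~ _) (sym a) (p , λ k → All.lookup ua (proj₂ (ends-visited p k)) (sym b)))
    path-crosses (step f j p) (ua ∷ up) (here r)  | no f≢e = ⊥-elim (f≢e (sym r))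
    path-crosses (step f j p) (ua ∷ up) (there i) | no f≢e with path-crosses p up i
    ... | inj₁ (r , s) = inj₁ (~-step f f≢e j r , s)
    ... | inj₂ (r , s) = inj₂ (~-step f f≢e j r , s)

    crossing-path : ∀ {a b} → a ~ u → v ~ b → ∃ λ (p : a ⇝ b) → Unique (verts p) × e ∈ₗ edgesOf p
    crossing-path (p₁ , a₁) (p₂ , a₂) with toPath p₁ | toPath p₂
    ... | q₁ , u₁ , e₁ | q₂ , u₂ , e₂ =
      p , subst Unique (sym verts-p) (UniqueP.++⁺ u₁ u₂ disjoint) , edges-▹ʳ q₁ _ (here refl)
      where
      p = q₁ ▹ step e (inj₁ (refl , refl)) q₂
      verts-p : verts p ≡ verts q₁ ++ verts q₂
      verts-p = trans (verts-▹ q₁ _) (trans (sym (ListP.++-assoc (initialVerts q₁) (u ∷ []) (verts q₂)))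
                  (cong (_++ verts q₂) (sym (verts-initialVerts q₁))))
      disjoint : ∀ {z} → ¬ (z ∈ₗ verts q₁ × z ∈ₗ verts q₂)
      disjoint (i₁ , i₂) = u≁v (~-trans (~-sym (proj₂ (~-along q₁ (a₁ ∘ e₁) i₁))) (~-sym (proj₁ (~-along q₂ (a₂ ∘ e₂) i₂))))

unique-length : ∀ {k} {xs ys : List (Fin k)} → Unique xs → (∀ {x} → x ∈ₗ xs → x ∈ₗ ys) → length xs ≤ length ys
unique-length {xs = []} u sub = z≤n
unique-length {xs = x ∷ xs} {ys} (x∉xs ∷ u) sub =
  P.subst (λ z → suc (length xs) ≤ z) (P.sym (length-remove x∈ys))
    (s≤s (unique-length u (λ {z} z∈ → remove-∈ x∈ys (sub (there z∈)) (All.lookup x∉xs z∈))))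
  where
  x∈ys = sub (here P.refl)
  remove : ∀ {x : Fin _} {ys} → x ∈ₗ ys → List (Fin _)
  remove {ys = _ ∷ ys} (here _)  = ys
  remove {ys = y ∷ _}  (there i) = y ∷ remove i
  length-remove : ∀ {x : Fin _} {ys} (i : x ∈ₗ ys) → length ys ≡ suc (length (remove i))
  length-remove (here _)  = P.refl
  length-remove (there i) = P.cong suc (length-remove i)
  remove-∈ : ∀ {x z : Fin _} {ys} (i : x ∈ₗ ys) → z ∈ₗ ys → x ≢ z → z ∈ₗ remove i
  remove-∈ (here r)  (here r′) x≢z = ⊥-elim (x≢z (P.trans r (P.sym r′)))
  remove-∈ (here r)  (there j) x≢z = j
  remove-∈ (there i) (here r′) x≢z = here r′
  remove-∈ (there i) (there j) x≢z = there (remove-∈ i j x≢z)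

module Degrees {n m : ℕ} (src tgt : Fin m → Fin n) where
  open P using (refl; sym; trans; subst)
  open Walks src tgt

  Incident : Fin m → Fin n → Set
  Incident f w = src f ≡ w ⊎ tgt f ≡ w

  degree-≥ : ∀ {w} (fs : List (Fin m)) → Unique fs → All (λ f → Incident f w) fs → length fs ≤ degree src tgt w
  degree-≥ {w} fs u inc = subst (length fs ≤_) (ListP.length-++ A)
     (unique-length u (λ {f} i → counted (All.lookup inc i)))
    where
    A = filter (λ e → src e ≟ w) (List.allFin m)
    B = filter (λ e → tgt e ≟ w) (List.allFin m)
    counted : ∀ {f} → Incident f w → f ∈ₗ A ++ B
    counted (inj₁ r) = ∈-++⁺ˡ (∈-filter⁺ (λ e → src e ≟ w) (∈-allFin _) r)
    counted (inj₂ r) = ∈-++⁺ʳ A (∈-filter⁺ (λ e → tgt e ≟ w) (∈-allFin _) r)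

  incident₁ : ∀ {f x y} → Joins src tgt f x y → Incident f x
  incident₁ (inj₁ (a , b)) = inj₁ a
  incident₁ (inj₂ (a , b)) = inj₂ b

  incident₂ : ∀ {f x y} → Joins src tgt f x y → Incident f y
  incident₂ (inj₁ (a , b)) = inj₂ b
  incident₂ (inj₂ (a , b)) = inj₁ a

  joins-twice : ∀ {f x y z} → Joins src tgt f x y → Joins src tgt f y z → x ≡ y ⊎ x ≡ z
  joins-twice (inj₁ (p , q)) (inj₁ (p′ , q′)) = inj₁ (trans (sym p) p′)
  joins-twice (inj₁ (p , q)) (inj₂ (p′ , q′)) = inj₂ (trans (sym p) p′)
  joins-twice (inj₂ (p , q)) (inj₁ (p′ , q′)) = inj₂ (trans (sym q) q′)
  joins-twice (inj₂ (p , q)) (inj₂ (p′ , q′)) = inj₁ (trans (sym q) q′)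

  initL-∷ : ∀ {c b} x (q : c ⇝ b) → initL (x ∷ verts q) ≡ x ∷ initL (verts q)
  initL-∷ x []           = refl
  initL-∷ x (step _ _ _) = refl

  visited-position : ∀ {a b w} (p : a ⇝ b) → w ∈ₗ verts p → w ≡ a ⊎ w ≡ b ⊎ w ∈ₗ interior p
  visited-position []           (here r)  = inj₁ r
  visited-position (step g j p) (here r)  = inj₁ r
  visited-position (step g j p) (there i) = inj₂ (later p i)
    where
    later : ∀ {c b w} (q : c ⇝ b) → w ∈ₗ verts q → w ≡ b ⊎ w ∈ₗ initL (verts q)
    later []           (here r) = inj₁ r
    later (step g j q) (here r) = inj₂ (subst (_ ∈ₗ_) (sym (initL-∷ _ q)) (here r))
    later (step g j q) (there i) with later q i
    ... | inj₁ r = inj₁ r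
    ... | inj₂ k = inj₂ (subst (_ ∈ₗ_) (sym (initL-∷ _ q)) (there k))

  interior-edges : ∀ {a b w} (p : a ⇝ b) → Unique (verts p) → w ∈ₗ interior p →
    ∃ λ g₁ → ∃ λ g₂ → g₁ ≢ g₂ × g₁ ∈ₗ edgesOf p × g₂ ∈ₗ edgesOf p × Incident g₁ w × Incident g₂ w
  interior-edges (step g j []) _ ()
  interior-edges {a} (step g j (step g′ j′ q)) (ua ∷ up) i with subst (_ ∈ₗ_) (initL-∷ _ q) i
  ... | here refl = g , g′ , g≢g′ , here refl , there (here refl) , incident₂ j , incident₁ j′
    where
    start : ∀ {x y} (q : x ⇝ y) → x ∈ₗ verts q
    start []           = here refl
    start (step _ _ _) = here refl
    g≢g′ : g ≢ g′
    g≢g′ refl with joins-twice j j′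
    ... | inj₁ r = All.lookup ua (here refl) r
    ... | inj₂ r = All.lookup ua (there (start q)) r
  ... | there k with interior-edges (step g′ j′ q) up k
  ... | g₁ , g₂ , g₁≢g₂ , i₁ , i₂ , c₁ , c₂ = g₁ , g₂ , g₁≢g₂ , there i₁ , there i₂ , c₁ , c₂

  first-edge : ∀ {a b} (p : a ⇝ b) → a ≢ b → ∃ λ g → g ∈ₗ edgesOf p × Incident g a
  first-edge []           a≢b = ⊥-elim (a≢b refl)
  first-edge (step g j p) _   = g , here refl , incident₁ j

  last-edge : ∀ {a b} (p : a ⇝ b) → a ≢ b → ∃ λ g → g ∈ₗ edgesOf p × Incident g b
  last-edge []           a≢b = ⊥-elim (a≢b refl)
  last-edge (step g j p) _   = go g j p
    where
    go : ∀ {a c b} h (jh : Joins src tgt h a c) (q : c ⇝ b) → ∃ λ g → g ∈ₗ edgesOf (step h jh q) × Incident g b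
    go h jh []           = h , here refl , incident₂ jh
    go h jh (step g j q) with go g j q
    ... | g′ , i , c = g′ , there i , c

-- If e separates the leaves a, b of a cherry, e lies on the path P from
-- a to b; every other leaf hangs off P at a non-bivalent interior vertex,
-- and two leaves on opposite sides of e hang off at different vertices,
-- so P would have two non-bivalent interior vertices.

module Cherry {n m : ℕ} (src tgt : Fin m → Fin n) (conn : ∀ u v → Walk src tgt u v) (count : suc m ≡ n)
              (leaf : Fin 4 → Fin n) (leaf-injective : ∀ i j → leaf i ≡ leaf j → i ≡ j)
              (leaf-degree : ∀ i → degree src tgt (leaf i) ≡ 1) where
  open P using (refl; sym; subst)
  open Walks src tgt
  open Tree src tgt conn count
  open Degrees src tgt
  open DecMembership (_≟_ {n}) using (_∈?_)
  open DecMembership (_≟_ {m}) using () renaming (_∈?_ to _∈ₑ?_)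

  NonBivalent : Fin n → Set
  NonBivalent w = degree src tgt w ≢ 2

  leaf-one-edge : ∀ i g₁ g₂ → g₁ ≢ g₂ → Incident g₁ (leaf i) → Incident g₂ (leaf i) → ⊥
  leaf-one-edge i g₁ g₂ g₁≢g₂ c₁ c₂
    with subst (2 ≤_) (leaf-degree i) (degree-≥ (g₁ ∷ g₂ ∷ []) ((g₁≢g₂ ∷ []) ∷ [] ∷ []) (c₁ ∷ c₂ ∷ []))
  ... | s≤s ()

  module _ (e : Fin m) where
    open Side e

    Separated : Fin n → Fin n → Set
    Separated x y = (x ~ u × y ~ v) ⊎ (x ~ v × y ~ u)

    separated-apart : ∀ {x y} → Separated x y → x ~ y → ⊥
    separated-apart (inj₁ (x~u , y~v)) x~y = u≁v (~-trans (~-sym x~u) (~-trans x~y y~v))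
    separated-apart (inj₂ (x~v , y~u)) x~y = u≁v (~-trans (~-sym y~u) (~-trans (~-sym x~y) x~v))

    enter : ∀ {x t} (q : x ⇝ t) → Avoids e q → (V : List (Fin n)) → x ∉ₗ V → t ∈ₗ V →
      ∃ λ y → ∃ λ w → ∃ λ f → y ∉ₗ V × w ∈ₗ V × Joins src tgt f y w × f ≢ e × x ~ y
    enter [] a V x∉ t∈ = ⊥-elim (x∉ t∈)
    enter {x} (step f j q) a V x∉ t∈ with _ ∈? V
    ... | yes w∈ = x , _ , f , x∉ , w∈ , j , (λ r → a (here (sym r))) , ~-refl
    ... | no w∉ with enter q (a ∘ there) V w∉ t∈
    ... | y , w , g , y∉ , w′∈ , jg , g≢e , r = y , w , g , y∉ , w′∈ , jg , g≢e , ~-step f (λ r → a (here (sym r))) j r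

    module _ {a b : Fin 4} (p : leaf a ⇝ leaf b) (p-path : Unique (verts p)) where

      leaves-distinct : a ≢ b → leaf a ≢ leaf b
      leaves-distinct a≢b r = a≢b (leaf-injective a b r)

      leaf-off-path : ∀ x → x ≢ a → x ≢ b → leaf x ∉ₗ verts p
      leaf-off-path x x≢a x≢b i with visited-position p i
      ... | inj₁ r        = x≢a (leaf-injective _ _ r)
      ... | inj₂ (inj₁ r) = x≢b (leaf-injective _ _ r)
      ... | inj₂ (inj₂ k) with interior-edges p p-path k
      ... | g₁ , g₂ , g₁≢g₂ , _ , _ , c₁ , c₂ = leaf-one-edge x g₁ g₂ g₁≢g₂ c₁ c₂

      hangs-off : a ≢ b → ∀ x → x ≢ a → x ≢ b → ∀ {t} → t ∈ₗ verts p → leaf x ~ t →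
        ∃ λ w → w ∈ₗ interior p × NonBivalent w × w ~ leaf x
      hangs-off a≢b x x≢a x≢b t∈ (q , aq) with enter q aq (verts p) (leaf-off-path x x≢a x≢b) t∈
      ... | y , w , f , y∉ , w∈ , jf , f≢e , x~y = attach (visited-position p w∈)
        where
        f∉p : f ∉ₗ edgesOf p
        f∉p k with incident₁ jf
        ... | inj₁ s = y∉ (subst (_∈ₗ verts p) s (proj₁ (ends-visited p k)))
        ... | inj₂ s = y∉ (subst (_∈ₗ verts p) s (proj₂ (ends-visited p k)))
        not-f : ∀ {g} → g ∈ₗ edgesOf p → g ≢ f
        not-f k refl = f∉p k
        attach : w ≡ leaf a ⊎ w ≡ leaf b ⊎ w ∈ₗ interior p → ∃ λ w → w ∈ₗ interior p × NonBivalent w × w ~ leaf x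
        attach (inj₁ refl) with first-edge p (leaves-distinct a≢b)
        ... | g , k , c = ⊥-elim (leaf-one-edge a g f (not-f k) c (incident₂ jf))
        attach (inj₂ (inj₁ refl)) with last-edge p (leaves-distinct a≢b)
        ... | g , k , c = ⊥-elim (leaf-one-edge b g f (not-f k) c (incident₂ jf))
        attach (inj₂ (inj₂ k)) with interior-edges p p-path k
        ... | g₁ , g₂ , g₁≢g₂ , k₁ , k₂ , c₁ , c₂ = w , k , three-edges , ~-step f f≢e (joins-sym jf) (~-sym x~y)
          where
          three-edges : NonBivalent w
          three-edges eq
            with subst (3 ≤_) eq (degree-≥ (g₁ ∷ g₂ ∷ f ∷ []) ((g₁≢g₂ ∷ not-f k₁ ∷ []) ∷ (not-f k₂ ∷ []) ∷ [] ∷ [])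
                                           (c₁ ∷ c₂ ∷ incident₂ jf ∷ []))
          ... | s≤s (s≤s ())

      cherry-unsplit : length (filter (λ w → ¬? (degree src tgt w ℕ.≟ 2)) (interior p)) ≡ 1 →
        a ≢ b → Separated (leaf a) (leaf b) →
        ∀ {x y} → x ≢ a → x ≢ b → y ≢ a → y ≢ b → Separated (leaf x) (leaf y) → ⊥
      cherry-unsplit one-stalk a≢b ab-sep {x} {y} x≢a x≢b y≢a y≢b xy-sep with e ∈ₑ? edgesOf p
      ... | no e∉p = separated-apart ab-sep (p , e∉p)
      ... | yes e∈p = opposite xy-sep
        where
        u∈p = proj₁ (ends-visited p e∈p)
        v∈p = proj₂ (ends-visited p e∈p)
        two-stalks : ∀ {w₁ w₂} → w₁ ≢ w₂ → w₁ ∈ₗ interior p → w₂ ∈ₗ interior p → NonBivalent w₁ → NonBivalent w₂ → ⊥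
        two-stalks w₁≢w₂ i₁ i₂ d₁ d₂
          with subst (2 ≤_) one-stalk
                 (unique-length ((w₁≢w₂ ∷ []) ∷ [] ∷ [])
                   (λ { (here refl) → ∈-filter⁺ (λ z → ¬? (degree src tgt z ℕ.≟ 2)) i₁ d₁
                      ; (there (here refl)) → ∈-filter⁺ (λ z → ¬? (degree src tgt z ℕ.≟ 2)) i₂ d₂ }))
        ... | s≤s ()
        -- leaves hanging off the same vertex are on the same side
        same-stalk : ∀ {t₁ t₂} → t₁ ∈ₗ verts p → t₂ ∈ₗ verts p → leaf x ~ t₁ → leaf y ~ t₂ → ⊥
        same-stalk t₁∈ t₂∈ x~ y~
          with hangs-off a≢b x x≢a x≢b t₁∈ x~ | hangs-off a≢b y y≢a y≢b t₂∈ y~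
        ... | w₁ , i₁ , d₁ , w₁~x | w₂ , i₂ , d₂ , w₂~y =
          two-stalks (λ { refl → separated-apart xy-sep (~-trans (~-sym w₁~x) w₂~y) }) i₁ i₂ d₁ d₂
        opposite : Separated (leaf x) (leaf y) → ⊥
        opposite (inj₁ (x~u , y~v)) = same-stalk u∈p v∈p x~u y~v
        opposite (inj₂ (x~v , y~u)) = same-stalk v∈p u∈p x~v y~u

-- A subset s of the leaves, read as the split (s, ∁ s), separates
-- I when I meets both parts. An edge e of a tree induces the split whose
-- parts are the leaves on either side of e, and e lies in the minimal
-- subtree spanned by I exactly when its split separates I.

Separates : ∀ {n} → Subset n → Subset n → Set
Separates s I = Nonempty (I ∩ s) × Nonempty (I ∩ ∁ s)

separates? : ∀ {n} (s I : Subset n) → Dec (Separates s I)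
separates? s I = SubsetP.nonempty? (I ∩ s) ×-dec SubsetP.nonempty? (I ∩ ∁ s)

Big : Subset 4 → Set
Big I = 2 ≤ ∣ I ∣

big? : ∀ I → Dec (Big I)
big? I = 2 ℕ.≤? ∣ I ∣

cherry₁ cherry₂ : Subset 4
cherry₁ = inside ∷ inside ∷ outside ∷ outside ∷ []
cherry₂ = outside ∷ outside ∷ inside ∷ inside ∷ []

Compatible : Subset 4 → Set
Compatible s = ¬ (Separates s cherry₁ × Separates s cherry₂)

compatible? : ∀ s → Dec (Compatible s)
compatible? s = ¬? (separates? s cherry₁ ×-dec separates? s cherry₂)

∈-cherry₁ : ∀ {c} → c ∈ cherry₁ → c ≡ zero ⊎ c ≡ suc zero
∈-cherry₁ {zero}                c∈ = inj₁ P.refl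
∈-cherry₁ {suc zero}            c∈ = inj₂ P.refl
∈-cherry₁ {suc (suc zero)}      (Vec.there (Vec.there ()))
∈-cherry₁ {suc (suc (suc zero))} (Vec.there (Vec.there (Vec.there ())))

∈-cherry₂ : ∀ {c} → c ∈ cherry₂ → c ≡ suc (suc zero) ⊎ c ≡ suc (suc (suc zero))
∈-cherry₂ {zero}                ()
∈-cherry₂ {suc zero}            (Vec.there ())
∈-cherry₂ {suc (suc zero)}      c∈ = inj₁ P.refl
∈-cherry₂ {suc (suc (suc zero))} c∈ = inj₂ P.refl

select : ∀ {k p} {Q : Fin k → Set p} → Decidable Q → Subset k
select Q? = tabulate (does ∘ Q?)

module _ {k p} {Q : Fin k → Set p} (Q? : Decidable Q) where

  select⁻ : ∀ {x} → x ∈ select Q? → Q x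
  select⁻ {x} x∈ with Q? x | P.trans (P.sym (VecP.lookup∘tabulate (does ∘ Q?) x)) (VecP.[]=⇒lookup x∈)
  ... | yes q | _  = q
  ... | no _  | ()

  select⁺ : ∀ {x} → Q x → x ∈ select Q?
  select⁺ {x} q = VecP.lookup⇒[]= x _ (P.trans (VecP.lookup∘tabulate (does ∘ Q?) x) (dec-true (Q? x) q))

module TreeMetric {c ℓ} (R : CommutativeRing c ℓ) (T : WTree R) where
  open CommutativeRing R using (_≈_) renaming (Carrier to A; refl to ≈-refl; sym to ≈-sym; trans to ≈-trans; reflexive to ≈-reflexive)
  open WTree T
  open P using (refl)
  open Walks src tgt
  open Tree src tgt connected edgeCount

  module _ (e : Fin m) where
    open Side e

    on-source-side? : ∀ x → Dec (x ~ u)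
    on-source-side? x = [ yes , (λ x~v → no (λ x~u → not-both-sides x~u x~v)) ]′ (side x)

    split : Subset 4
    split = select (λ i → on-source-side? (leaf i))

    source-side⁺ : ∀ {j} → leaf j ~ u → j ∈ split
    source-side⁺ = select⁺ (λ i → on-source-side? (leaf i))

    source-side⁻ : ∀ {j} → j ∈ split → leaf j ~ u
    source-side⁻ = select⁻ (λ i → on-source-side? (leaf i))

    target-side⁺ : ∀ {j} → leaf j ~ v → j ∈ ∁ split
    target-side⁺ j~v = SubsetP.x∉p⇒x∈∁p (λ j∈ → not-both-sides (source-side⁻ j∈) j~v)

    target-side⁻ : ∀ {j} → j ∈ ∁ split → leaf j ~ v
    target-side⁻ {j} j∈ = [ (λ j~u → ⊥-elim (SubsetP.x∈∁p⇒x∉p j∈ (source-side⁺ j~u))) , (λ j~v → j~v) ]′ (side (leaf j))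

    separates⇔min-subtree : ∀ I → (Separates split I → InMinSubtree R T I e) × (InMinSubtree R T I e → Separates split I)
    separates⇔min-subtree I = to , from
      where
      to : Separates split I → InMinSubtree R T I e
      to ((i , i∈) , (i′ , i′∈)) with SubsetP.x∈p∩q⁻ I split i∈ | SubsetP.x∈p∩q⁻ I (∁ split) i′∈
      ... | i∈I , i∈s | i′∈I , i′∈∁s =
        i , i′ , i∈I , i′∈I , crossing-path (source-side⁻ i∈s) (~-sym (target-side⁻ i′∈∁s))
      from : InMinSubtree R T I e → Separates split I
      from (i , i′ , i∈I , i′∈I , p , p-path , e∈p) with path-crosses p p-path e∈p
      ... | inj₁ (i~u , v~i′) =
        (i , SubsetP.x∈p∩q⁺ (i∈I , source-side⁺ i~u)) , (i′ , SubsetP.x∈p∩q⁺ (i′∈I , target-side⁺ (~-sym v~i′)))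
      ... | inj₂ (i~v , u~i′) =
        (i′ , SubsetP.x∈p∩q⁺ (i′∈I , source-side⁺ (~-sym u~i′))) , (i , SubsetP.x∈p∩q⁺ (i∈I , target-side⁺ i~v))

  edgesSeparating : Subset 4 → Subset m
  edgesSeparating I = select (λ e → separates? (split e) I)

  treeMetric : Subset 4 → A
  treeMetric I = sumSub R (edgesSeparating I) wt

  in-min-subtree⁻ : ∀ I {e} → e ∈ edgesSeparating I → InMinSubtree R T I e
  in-min-subtree⁻ I {e} e∈ = proj₁ (separates⇔min-subtree e I) (select⁻ (λ e → separates? (split e) I) e∈)

  in-min-subtree⁺ : ∀ I {e} → InMinSubtree R T I e → e ∈ edgesSeparating I
  in-min-subtree⁺ I {e} e∈ = select⁺ (λ e → separates? (split e) I) (proj₂ (separates⇔min-subtree e I) e∈)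

  realised-by-treeMetric : ∀ {D} → (∀ I → Big I → treeMetric I ≈ D I) → Realises R T D
  realised-by-treeMetric agree I big = edgesSeparating I , (λ e → in-min-subtree⁻ I , in-min-subtree⁺ I) , agree I big

  realises-treeMetric : Realises R T treeMetric
  realises-treeMetric = realised-by-treeMetric (λ _ _ → ≈-refl)

  -- and nothing else: the edge set of a minimal subtree is determined
  realised⇒treeMetric : ∀ {D} → Realises R T D → ∀ I → Big I → D I ≈ treeMetric I
  realised⇒treeMetric real I big with real I big
  ... | S , S⇔ , S≈D = ≈-trans (≈-sym S≈D) (≈-reflexive (P.cong (λ S → sumSub R S wt) S≡))
    where
    S≡ : S ≡ edgesSeparating I
    S≡ = SubsetP.⊆-antisym (λ {e} e∈ → in-min-subtree⁺ I (proj₁ (S⇔ e) e∈)) (λ {e} e∈ → proj₂ (S⇔ e) (in-min-subtree⁻ I e∈))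

  compatible-splits : IsCherry R T (# 0) (# 1) → ∀ e → Compatible (split e)
  compatible-splits (p , p-path , one-stalk) e (((c , c∈) , (d , d∈)) , ((x , x∈) , (y , y∈)))
    with SubsetP.x∈p∩q⁻ cherry₁ _ c∈ | SubsetP.x∈p∩q⁻ cherry₁ _ d∈ | SubsetP.x∈p∩q⁻ cherry₂ _ x∈ | SubsetP.x∈p∩q⁻ cherry₂ _ y∈
  ... | c∈₁ , c∈s | d∈₁ , d∈∁s | x∈₂ , x∈s | y∈₂ , y∈∁s =
    cherry-unsplit e p p-path one-stalk (λ ())
      (separated (∈-cherry₁ c∈₁) (∈-cherry₁ d∈₁) (source-side⁻ e c∈s) (target-side⁻ e d∈∁s))
      {# 2} {# 3} (λ ()) (λ ()) (λ ()) (λ ())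
      (separated (∈-cherry₂ x∈₂) (∈-cherry₂ y∈₂) (source-side⁻ e x∈s) (target-side⁻ e y∈∁s))
    where
    open Cherry src tgt connected edgeCount leaf leafInj leafDeg
    open Side e
    separated : ∀ {a b c d} → c ≡ a ⊎ c ≡ b → d ≡ a ⊎ d ≡ b → leaf c ~ u → leaf d ~ v → Separated e (leaf a) (leaf b)
    separated (inj₁ refl) (inj₁ refl) c~u d~v = ⊥-elim (not-both-sides c~u d~v)
    separated (inj₁ refl) (inj₂ refl) c~u d~v = inj₁ (c~u , d~v)
    separated (inj₂ refl) (inj₁ refl) c~u d~v = inj₂ (d~v , c~u)
    separated (inj₂ refl) (inj₂ refl) c~u d~v = ⊥-elim (not-both-sides c~u d~v)

-- Linear identities between sums of edge weights. The total weight of a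
-- list of edge sets only depends on how often each edge occurs in it.

countTrue : ∀ {a} {X : Set a} → (X → Bool) → List X → ℕ
countTrue p []       = 0
countTrue p (x ∷ xs) = if p x then suc (countTrue p xs) else countTrue p xs

countTrue-map : ∀ {a b} {X : Set a} {Y : Set b} (p : Y → Bool) (q : X → Bool) (f : X → Y) →
  (∀ x → p (f x) ≡ q x) → ∀ xs → countTrue p (List.map f xs) ≡ countTrue q xs
countTrue-map p q f pf≡q []       = P.refl
countTrue-map p q f pf≡q (x ∷ xs) rewrite pf≡q x | countTrue-map p q f pf≡q xs = P.refl

multiplicity : ∀ {k} → List (Subset k) → Fin k → ℕ
multiplicity Ss e = countTrue (λ S → lookup S e) Ss

module Sums {c ℓ} (R : CommutativeRing c ℓ) where
  open CommutativeRing R hiding (zero)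
  open import Algebra.Properties.Monoid.Mult +-monoid using () renaming (_×_ to _·_)
  open import Algebra.Properties.CommutativeSemigroup +-commutativeSemigroup using (interchange)
  open import Relation.Binary.Reasoning.Setoid setoid

  sumOver : ∀ {a} {X : Set a} → (X → Carrier) → List X → Carrier
  sumOver f []       = 0#
  sumOver f (x ∷ xs) = f x + sumOver f xs

  sumOver-map : ∀ {a b} {X : Set a} {Y : Set b} (f : Y → Carrier) (g : X → Y) xs →
    sumOver f (List.map g xs) ≡ sumOver (f ∘ g) xs
  sumOver-map f g []       = P.refl
  sumOver-map f g (x ∷ xs) = P.cong (λ r → f (g x) + r) (sumOver-map f g xs)

  sumOver-cong : ∀ {a} {X : Set a} {f g : X → Carrier} {xs} → All (λ x → f x ≈ g x) xs → sumOver f xs ≈ sumOver g xs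
  sumOver-cong []           = refl
  sumOver-cong (fx≈gx ∷ eqs) = +-cong fx≈gx (sumOver-cong eqs)

  totalWeight : ∀ {k} → List (Subset k) → (Fin k → Carrier) → Carrier
  totalWeight Ss w = sumOver (λ S → sumSub R S w) Ss

  totalWeight-first : ∀ {k} (Ss : List (Subset (suc k))) w →
    totalWeight Ss w ≈ multiplicity Ss zero · w zero + totalWeight (List.map Vec.tail Ss) (w ∘ suc)
  totalWeight-first [] w = sym (+-identityʳ _)
  totalWeight-first ((b ∷ S) ∷ Ss) w = begin
    sumSub R (b ∷ S) w + totalWeight Ss w
      ≈⟨ +-congˡ (totalWeight-first Ss w) ⟩
    sumSub R (b ∷ S) w + (multiplicity Ss zero · w zero + totalWeight Ss′ (w ∘ suc))
      ≈⟨ first b ⟩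
    (multiplicity ((b ∷ S) ∷ Ss) zero · w zero) + (sumSub R S (w ∘ suc) + totalWeight Ss′ (w ∘ suc)) ∎
    where
    Ss′ = List.map Vec.tail Ss
    first : ∀ b → sumSub R (b ∷ S) w + (multiplicity Ss zero · w zero + totalWeight Ss′ (w ∘ suc)) ≈
                  (multiplicity ((b ∷ S) ∷ Ss) zero · w zero) + (sumSub R S (w ∘ suc) + totalWeight Ss′ (w ∘ suc))
    first true  = interchange _ _ _ _
    first false = trans (interchange _ _ _ _) (+-congʳ (+-identityˡ _))

  no-edges : ∀ (Ss : List (Subset 0)) w → totalWeight Ss w ≈ 0#
  no-edges []        w = refl
  no-edges ([] ∷ Ss) w = trans (+-identityˡ _) (no-edges Ss w)

  totalWeight-cong : ∀ {k} (Ss Ts : List (Subset k)) w → (∀ e → multiplicity Ss e ≡ multiplicity Ts e) →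
    totalWeight Ss w ≈ totalWeight Ts w
  totalWeight-cong {zero}  Ss Ts w same = trans (no-edges Ss w) (sym (no-edges Ts w))
  totalWeight-cong {suc k} Ss Ts w same = begin
    totalWeight Ss w
      ≈⟨ totalWeight-first Ss w ⟩
    multiplicity Ss zero · w zero + totalWeight (List.map Vec.tail Ss) (w ∘ suc)
      ≈⟨ +-cong (reflexive (P.cong (_· w zero) (same zero)))
                (totalWeight-cong (List.map Vec.tail Ss) (List.map Vec.tail Ts) (w ∘ suc) same-tail) ⟩
    multiplicity Ts zero · w zero + totalWeight (List.map Vec.tail Ts) (w ∘ suc)
      ≈⟨ totalWeight-first Ts w ⟨
    totalWeight Ts w
      ∎
    where
    tail-multiplicity : ∀ (Us : List (Subset (suc k))) e → multiplicity (List.map Vec.tail Us) e ≡ multiplicity Us (suc e)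
    tail-multiplicity Us e = countTrue-map _ _ Vec.tail (λ { (b ∷ S) → P.refl }) Us
    same-tail : ∀ e → multiplicity (List.map Vec.tail Ss) e ≡ multiplicity (List.map Vec.tail Ts) e
    same-tail e = P.trans (tail-multiplicity Ss e) (P.trans (same (suc e)) (P.sym (tail-multiplicity Ts e)))

-- A linear identity  Σ_{I ∈ Is} D_I = Σ_{J ∈ Js} D_J  holds for
-- every realisable family as soon as every compatible split separates as
-- many sets of Is as of Js. This is a finite check.

separations : Subset 4 → List (Subset 4) → ℕ
separations s = countTrue (λ I → does (separates? s I))

Certificate : List (Subset 4) → List (Subset 4) → Set
Certificate Is Js = All Big Is × All Big Js × (∀ s → Compatible s → separations s Is ≡ separations s Js)

allSubsets? : ∀ {n p} {Q : Subset n → Set p} → Decidable Q → Dec (∀ X → Q X)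
allSubsets? {zero}  Q? = map′ (λ q → λ { [] → q }) (λ f → f []) (Q? [])
allSubsets? {suc n} Q? = map′ (λ (q , q′) → λ { (inside ∷ X) → q X ; (outside ∷ X) → q′ X })
                              (λ f → f ∘ (inside ∷_) , f ∘ (outside ∷_))
                              (allSubsets? (Q? ∘ (inside ∷_)) ×-dec allSubsets? (Q? ∘ (outside ∷_)))

certificate? : ∀ Is Js → Dec (Certificate Is Js)
certificate? Is Js = All.all? big? Is ×-dec All.all? big? Js ×-dec
  allSubsets? (λ s → compatible? s →-dec (separations s Is ℕ.≟ separations s Js))

module TreeIdentities {c ℓ} (R : CommutativeRing c ℓ) where
  open CommutativeRing R using (_≈_; setoid) renaming (Carrier to A)
  open Sums R
  open Relation.Binary.Reasoning.Setoid setoid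

  TreeLike : (Subset 4 → A) → Set ℓ
  TreeLike D = ∀ Is Js → Certificate Is Js → sumOver D Is ≈ sumOver D Js

  module _ (T : WTree R) where
    open WTree T
    open TreeMetric R T

    treeMetric-treeLike : (∀ e → Compatible (split e)) → TreeLike treeMetric
    treeMetric-treeLike compatible Is Js (_ , _ , same) = begin
      sumOver treeMetric Is                                     ≡⟨ sumOver-map _ edgesSeparating Is ⟨
      totalWeight (List.map edgesSeparating Is) wt
        ≈⟨ totalWeight-cong (List.map edgesSeparating Is) (List.map edgesSeparating Js) wt same-multiplicity ⟩
      totalWeight (List.map edgesSeparating Js) wt              ≡⟨ sumOver-map _ edgesSeparating Js ⟩
      sumOver treeMetric Js                                     ∎
      where
      multiplicity≡separations : ∀ Ks e → multiplicity (List.map edgesSeparating Ks) e ≡ separations (split e) Ks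
      multiplicity≡separations Ks e =
        countTrue-map _ _ edgesSeparating (λ I → VecP.lookup∘tabulate (λ e → does (separates? (split e) I)) e) Ks
      same-multiplicity : ∀ e → multiplicity (List.map edgesSeparating Is) e ≡ multiplicity (List.map edgesSeparating Js) e
      same-multiplicity e = P.trans (multiplicity≡separations Is e)
        (P.trans (same (split e) (compatible e)) (P.sym (multiplicity≡separations Js e)))

    realised-treeLike : IsCherry R T (# 0) (# 1) → ∀ {D} → Realises R T D → TreeLike D
    realised-treeLike cherry real Is Js cert@(big-Is , big-Js , _) = begin
      sumOver _ Is            ≈⟨ sumOver-cong (All.map (realised⇒treeMetric real _) big-Is) ⟩
      sumOver treeMetric Is   ≈⟨ treeMetric-treeLike (compatible-splits cherry) Is Js cert ⟩
      sumOver treeMetric Js   ≈⟨ sumOver-cong (All.map (realised⇒treeMetric real _) big-Js) ⟨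
      sumOver _ Js            ∎

StarCertificates : Subset 4 → Set
StarCertificates α = ∀ e → e ∈ α → ∀ e′ → e′ ∈ α →
  ∀ X → Nonempty X → e ∉ X → e′ ∉ X → ∀ X′ → Nonempty X′ → e ∉ X′ → e′ ∉ X′ →
  Certificate (⁅ e ⁆ ∪ X ∷ ⁅ e′ ⁆ ∪ X′ ∷ []) (⁅ e ⁆ ∪ X′ ∷ ⁅ e′ ⁆ ∪ X ∷ [])

starCertificates? : ∀ α → Dec (StarCertificates α)
starCertificates? α =
  FinP.all? λ e → e SubsetP.∈? α →-dec FinP.all? λ e′ → e′ SubsetP.∈? α →-dec
  allSubsets? λ X → SubsetP.nonempty? X →-dec ¬? (e SubsetP.∈? X) →-dec ¬? (e′ SubsetP.∈? X) →-dec
  allSubsets? λ X′ → SubsetP.nonempty? X′ →-dec ¬? (e SubsetP.∈? X′) →-dec ¬? (e′ SubsetP.∈? X′) →-dec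
  certificate? _ _

IsIndex : Fin 4 → Subset 4 → Set
IsIndex i X = i ∉ X × 2 ≤ ∣ ⁅ i ⁆ ∪ X ∣

isIndex? : ∀ i X → Dec (IsIndex i X)
isIndex? i X = ¬? (i SubsetP.∈? X) ×-dec (2 ℕ.≤? ∣ ⁅ i ⁆ ∪ X ∣)

ACertificates : Set
ACertificates = ∀ i → i ∈ cherry₁ → ∀ j → j ∈ cherry₂ →
  ∀ Z → Z ⊆ cherry₁ → IsIndex i Z → IsIndex j Z →
  ∀ Y → Y ⊆ cherry₂ → IsIndex i Y → IsIndex j Y →
  ∀ W → Nonempty (W ∩ cherry₁) → Nonempty (W ∩ cherry₂) → IsIndex j W → IsIndex i W →
  Certificate (⁅ j ⁆ ∪ Z ∷ ⁅ j ⁆ ∪ Y ∷ ⁅ i ⁆ ∪ W ∷ ⁅ i ⁆ ∪ W ∷ []) (⁅ i ⁆ ∪ Z ∷ ⁅ i ⁆ ∪ Y ∷ ⁅ j ⁆ ∪ W ∷ ⁅ j ⁆ ∪ W ∷ [])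

aCertificates? : Dec ACertificates
aCertificates? =
  FinP.all? λ i → i SubsetP.∈? cherry₁ →-dec FinP.all? λ j → j SubsetP.∈? cherry₂ →-dec
  allSubsets? λ Z → Z SubsetP.⊆? cherry₁ →-dec isIndex? i Z →-dec isIndex? j Z →-dec
  allSubsets? λ Y → Y SubsetP.⊆? cherry₂ →-dec isIndex? i Y →-dec isIndex? j Y →-dec
  allSubsets? λ W → SubsetP.nonempty? (W ∩ cherry₁) →-dec SubsetP.nonempty? (W ∩ cherry₂) →-dec
    isIndex? j W →-dec isIndex? i W →-dec certificate? _ _

BCertificates : Set
BCertificates = ∀ i → i ∈ cherry₁ → ∀ j → j ∈ cherry₁ → i ≢ j →
  ∀ X → X ⊆ cherry₂ → Nonempty X → ∀ δ → δ ⊆ cherry₂ → Nonempty δ →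
  Certificate (⁅ i ⁆ ∪ ⁅ j ⁆ ∷ ⁅ i ⁆ ∪ X ∷ ⁅ j ⁆ ∪ δ ∷ ⁅ j ⁆ ∪ δ ∷ [])
              (⁅ j ⁆ ∪ X ∷ ⁅ i ⁆ ∪ ⁅ j ⁆ ∪ δ ∷ ⁅ i ⁆ ∪ ⁅ j ⁆ ∪ δ ∷ [])

bCertificates? : Dec BCertificates
bCertificates? =
  FinP.all? λ i → i SubsetP.∈? cherry₁ →-dec FinP.all? λ j → j SubsetP.∈? cherry₁ →-dec ¬? (i ≟ j) →-dec
  allSubsets? λ X → X SubsetP.⊆? cherry₂ →-dec SubsetP.nonempty? X →-dec
  allSubsets? λ δ → δ SubsetP.⊆? cherry₂ →-dec SubsetP.nonempty? δ →-dec certificate? _ _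

-- all of them are verified by evaluation
star-certificates₁ : StarCertificates cherry₁
star-certificates₁ = toWitness {a? = starCertificates? cherry₁} _

star-certificates₂ : StarCertificates cherry₂
star-certificates₂ = toWitness {a? = starCertificates? cherry₂} _

a-certificates : ACertificates
a-certificates = toWitness {a? = aCertificates?} _

b-certificates : BCertificates
b-certificates = toWitness {a? = bCertificates?} _

module Conditions {c ℓ} (R : CommutativeRing c ℓ) (D : Subset 4 → CommutativeRing.Carrier R)
                  (tree-like : TreeIdentities.TreeLike R D) where
  open RingFacts R

  pseudo-cherry : ∀ α → StarCertificates α → PseudoCherry R D α
  pseudo-cherry α certs e e′ e∈ e′∈ X X′ ne ne′ e∉X e′∉X e∉X′ e′∉X′ =
    exchange _ _ _ _ (tree-like _ _ (certs e e∈ e′ e′∈ X ne e∉X e′∉X X′ ne′ e∉X′ e′∉X′))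

  condition-A : CondA R D
  condition-A i j Z Y W i∈ j∈ Z⊆ Y⊆ W₁ W₂ iZ jZ iY jY jW iW =
    doubled-difference _ _ _ _ _ _ (tree-like _ _ (a-certificates i i∈ j j∈ Z Z⊆ iZ jZ Y Y⊆ iY jY W W₁ W₂ jW iW))

  condition-B : ∀ h → CondB R D h
  condition-B (h , h+h≈1) i j i∈ j∈ i≢j X δ X⊆ X≠∅ δ⊆ δ≠∅ =
    Halving.halved-difference h h+h≈1 _ _ _ _ _ (tree-like _ _ (b-certificates i i∈ j j∈ i≢j X X⊆ X≠∅ δ δ⊆ δ≠∅))

-- The quartet tree: leaves 0, 1 hang off the vertex 4, leaves 2, 3 off the
-- vertex 5, and the inner edge joins 4 and 5.

module QuartetTree where
  open P using (refl)

  src tgt : Fin 5 → Fin 6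
  src zero                         = # 0
  src (suc zero)                   = # 1
  src (suc (suc zero))             = # 2
  src (suc (suc (suc zero)))       = # 3
  src (suc (suc (suc (suc zero)))) = # 4
  tgt zero                         = # 4
  tgt (suc zero)                   = # 4
  tgt (suc (suc zero))             = # 5
  tgt (suc (suc (suc zero)))       = # 5
  tgt (suc (suc (suc (suc zero)))) = # 5

  open Walks src tgt

  leaf : Fin 4 → Fin 6
  leaf i = i Fin.↑ˡ 2

  to-4 : ∀ x → x ⇝ # 4
  to-4 zero                               = step (# 0) (inj₁ (refl , refl)) []
  to-4 (suc zero)                         = step (# 1) (inj₁ (refl , refl)) []
  to-4 (suc (suc zero))                   = step (# 2) (inj₁ (refl , refl)) (step (# 4) (inj₂ (refl , refl)) [])
  to-4 (suc (suc (suc zero)))             = step (# 3) (inj₁ (refl , refl)) (step (# 4) (inj₂ (refl , refl)) [])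
  to-4 (suc (suc (suc (suc zero))))       = []
  to-4 (suc (suc (suc (suc (suc zero))))) = step (# 4) (inj₂ (refl , refl)) []

  connected : ∀ x y → x ⇝ y
  connected x y = to-4 x ▹ reverse (to-4 y)

  leaf-injective : ∀ i j → leaf i ≡ leaf j → i ≡ j
  leaf-injective i j = FinP.↑ˡ-injective 2 i j

  leaf-degree : ∀ i → degree src tgt (leaf i) ≡ 1
  leaf-degree zero                   = refl
  leaf-degree (suc zero)             = refl
  leaf-degree (suc (suc zero))       = refl
  leaf-degree (suc (suc (suc zero))) = refl

  degree-one-is-leaf : ∀ v → degree src tgt v ≡ 1 → ∃ λ i → leaf i ≡ v
  degree-one-is-leaf zero                               _ = # 0 , refl
  degree-one-is-leaf (suc zero)                         _ = # 1 , refl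
  degree-one-is-leaf (suc (suc zero))                   _ = # 2 , refl
  degree-one-is-leaf (suc (suc (suc zero)))             _ = # 3 , refl
  degree-one-is-leaf (suc (suc (suc (suc zero))))       ()
  degree-one-is-leaf (suc (suc (suc (suc (suc zero))))) ()

  module _ {c ℓ} (R : CommutativeRing c ℓ) where

    quartet : (Fin 5 → CommutativeRing.Carrier R) → WTree R
    quartet w = record
      { n = 6 ; m = 5 ; src = src ; tgt = tgt ; wt = w ; leaf = leaf
      ; connected = connected ; edgeCount = refl
      ; leafInj = leaf-injective ; leafDeg = leaf-degree ; degLeaf = degree-one-is-leaf }

    -- the paths 0 - 4 - 1 and 2 - 5 - 3 have the single inner vertex 4, resp. 5, of degree 3
    cherry₀₁ : ∀ w → IsCherry R (quartet w) (# 0) (# 1)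
    cherry₀₁ w = step (# 0) (inj₁ (refl , refl)) (step (# 1) (inj₂ (refl , refl)) []) ,
                 ((λ ()) ∷ (λ ()) ∷ []) ∷ ((λ ()) ∷ []) ∷ [] ∷ [] , refl

    cherry₂₃ : ∀ w → IsCherry R (quartet w) (# 2) (# 3)
    cherry₂₃ w = step (# 2) (inj₁ (refl , refl)) (step (# 3) (inj₂ (refl , refl)) []) ,
                 ((λ ()) ∷ (λ ()) ∷ []) ∷ ((λ ()) ∷ []) ∷ [] ∷ [] , refl

-- Conditions (A) and (B) determine a family from its values on pairs.
-- (B) gives D_{012}, D_{013}, D_{0123} from D_{02}, D_{03}, D_{023};
-- (A) gives 2 D_{023} and 2 D_{123} from pairs and D_{013}.

ASideConditions : Fin 4 → Fin 4 → Subset 4 → Subset 4 → Subset 4 → Set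
ASideConditions i j Z Y W =
  i ∈ cherry₁ × j ∈ cherry₂ × Z ⊆ cherry₁ × Y ⊆ cherry₂ × Nonempty (W ∩ cherry₁) × Nonempty (W ∩ cherry₂) ×
  IsIndex i Z × IsIndex j Z × IsIndex i Y × IsIndex j Y × IsIndex j W × IsIndex i W

aSideConditions? : ∀ i j Z Y W → Dec (ASideConditions i j Z Y W)
aSideConditions? i j Z Y W =
  i SubsetP.∈? cherry₁ ×-dec j SubsetP.∈? cherry₂ ×-dec Z SubsetP.⊆? cherry₁ ×-dec Y SubsetP.⊆? cherry₂ ×-dec
  SubsetP.nonempty? (W ∩ cherry₁) ×-dec SubsetP.nonempty? (W ∩ cherry₂) ×-dec
  isIndex? i Z ×-dec isIndex? j Z ×-dec isIndex? i Y ×-dec isIndex? j Y ×-dec isIndex? j W ×-dec isIndex? i W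

BSideConditions : Fin 4 → Fin 4 → Subset 4 → Subset 4 → Set
BSideConditions i j X δ = i ∈ cherry₁ × j ∈ cherry₁ × i ≢ j × X ⊆ cherry₂ × Nonempty X × δ ⊆ cherry₂ × Nonempty δ

bSideConditions? : ∀ i j X δ → Dec (BSideConditions i j X δ)
bSideConditions? i j X δ =
  i SubsetP.∈? cherry₁ ×-dec j SubsetP.∈? cherry₁ ×-dec ¬? (i ≟ j) ×-dec
  X SubsetP.⊆? cherry₂ ×-dec SubsetP.nonempty? X ×-dec δ SubsetP.⊆? cherry₂ ×-dec SubsetP.nonempty? δ

module Determination {c ℓ} (R : CommutativeRing c ℓ) (half : Half R) where
  open CommutativeRing R renaming (Carrier to A)
  open RingFacts R
  open Relation.Binary.Reasoning.Setoid setoid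

  condition-A-at : ∀ E → CondA R E → ∀ i j Z Y W → ASideConditions i j Z Y W →
    - E (⁅ i ⁆ ∪ Z) + E (⁅ j ⁆ ∪ Z) − E (⁅ i ⁆ ∪ Y) + E (⁅ j ⁆ ∪ Y) ≈ two * (E (⁅ j ⁆ ∪ W) − E (⁅ i ⁆ ∪ W))
  condition-A-at E cond i j Z Y W (i∈ , j∈ , Z⊆ , Y⊆ , W₁ , W₂ , iZ , jZ , iY , jY , jW , iW) =
    cond i j Z Y W i∈ j∈ Z⊆ Y⊆ W₁ W₂ iZ jZ iY jY jW iW

  condition-B-at : ∀ E → CondB R E half → ∀ i j X δ → BSideConditions i j X δ →
    E (⁅ i ⁆ ∪ ⁅ j ⁆ ∪ δ) ≈ aOf R E half i j X + E (⁅ j ⁆ ∪ δ)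
  condition-B-at E cond i j X δ (i∈ , j∈ , i≢j , X⊆ , X≠∅ , δ⊆ , δ≠∅) = cond i j i∈ j∈ i≢j X δ X⊆ X≠∅ δ⊆ δ≠∅

  module _ (E E′ : Subset 4 → A)
           (A-E : CondA R E) (B-E : CondB R E half) (A-E′ : CondA R E′) (B-E′ : CondB R E′ half)
           (pairs : ∀ I → ∣ I ∣ ≡ 2 → E I ≈ E′ I) where

    pair : ∀ {I} → ∣ I ∣ ≡ 2 → E I ≈ E′ I
    pair = pairs _

    via-B : ∀ δ → {_ : True (bSideConditions? (# 1) (# 0) ⁅ # 2 ⁆ δ)} →
      E (⁅ # 0 ⁆ ∪ δ) ≈ E′ (⁅ # 0 ⁆ ∪ δ) → E (⁅ # 1 ⁆ ∪ ⁅ # 0 ⁆ ∪ δ) ≈ E′ (⁅ # 1 ⁆ ∪ ⁅ # 0 ⁆ ∪ δ)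
    via-B δ {side} eq = begin
      E (⁅ # 1 ⁆ ∪ ⁅ # 0 ⁆ ∪ δ)                ≈⟨ condition-B-at E B-E (# 1) (# 0) ⁅ # 2 ⁆ δ (toWitness side) ⟩
      aOf R E half (# 1) (# 0) ⁅ # 2 ⁆ + E (⁅ # 0 ⁆ ∪ δ)  ≈⟨ +-cong pendant-weight eq ⟩
      aOf R E′ half (# 1) (# 0) ⁅ # 2 ⁆ + E′ (⁅ # 0 ⁆ ∪ δ) ≈⟨ condition-B-at E′ B-E′ (# 1) (# 0) ⁅ # 2 ⁆ δ (toWitness side) ⟨
      E′ (⁅ # 1 ⁆ ∪ ⁅ # 0 ⁆ ∪ δ)               ∎
      where
      pendant-weight : aOf R E half (# 1) (# 0) ⁅ # 2 ⁆ ≈ aOf R E′ half (# 1) (# 0) ⁅ # 2 ⁆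
      pendant-weight = *-congˡ (+-cong (+-cong (pair P.refl) (pair P.refl)) (-‿cong (pair P.refl)))

    -- (A) with Z, Y singletons, so that only D_{jW} and D_{iW} are not pairs
    via-A : ∀ i j Z Y W → {_ : True (aSideConditions? i j Z Y W)} →
      ∣ ⁅ i ⁆ ∪ Z ∣ ≡ 2 → ∣ ⁅ j ⁆ ∪ Z ∣ ≡ 2 → ∣ ⁅ i ⁆ ∪ Y ∣ ≡ 2 → ∣ ⁅ j ⁆ ∪ Y ∣ ≡ 2 →
      E (⁅ i ⁆ ∪ W) ≈ E′ (⁅ i ⁆ ∪ W) → E (⁅ j ⁆ ∪ W) ≈ E′ (⁅ j ⁆ ∪ W)
    via-A i j Z Y W {side} iZ jZ iY jY eq =
      difference-injective (Halving.cancel-two (proj₁ half) (proj₂ half) (begin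
        two * (E (⁅ j ⁆ ∪ W) − E (⁅ i ⁆ ∪ W))   ≈⟨ condition-A-at E A-E i j Z Y W (toWitness side) ⟨
        - E (⁅ i ⁆ ∪ Z) + E (⁅ j ⁆ ∪ Z) − E (⁅ i ⁆ ∪ Y) + E (⁅ j ⁆ ∪ Y)
          ≈⟨ +-cong (+-cong (+-cong (-‿cong (pair iZ)) (pair jZ)) (-‿cong (pair iY))) (pair jY) ⟩
        - E′ (⁅ i ⁆ ∪ Z) + E′ (⁅ j ⁆ ∪ Z) − E′ (⁅ i ⁆ ∪ Y) + E′ (⁅ j ⁆ ∪ Y)
          ≈⟨ condition-A-at E′ A-E′ i j Z Y W (toWitness side) ⟩
        two * (E′ (⁅ j ⁆ ∪ W) − E′ (⁅ i ⁆ ∪ W)) ∎)) eq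

    e₀₁₃ : E (inside ∷ inside ∷ outside ∷ inside ∷ []) ≈ E′ (inside ∷ inside ∷ outside ∷ inside ∷ [])
    e₀₁₃ = via-B ⁅ # 3 ⁆ (pair P.refl)

    e₀₂₃ : E (inside ∷ outside ∷ inside ∷ inside ∷ []) ≈ E′ (inside ∷ outside ∷ inside ∷ inside ∷ [])
    e₀₂₃ = via-A (# 1) (# 2) ⁅ # 0 ⁆ ⁅ # 3 ⁆ (⁅ # 0 ⁆ ∪ ⁅ # 3 ⁆) P.refl P.refl P.refl P.refl e₀₁₃

    agree : ∀ I → Big I → E I ≈ E′ I
    agree (inside  ∷ inside  ∷ outside ∷ outside ∷ []) _ = pair P.refl
    agree (inside  ∷ outside ∷ inside  ∷ outside ∷ []) _ = pair P.refl
    agree (inside  ∷ outside ∷ outside ∷ inside  ∷ []) _ = pair P.refl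
    agree (outside ∷ inside  ∷ inside  ∷ outside ∷ []) _ = pair P.refl
    agree (outside ∷ inside  ∷ outside ∷ inside  ∷ []) _ = pair P.refl
    agree (outside ∷ outside ∷ inside  ∷ inside  ∷ []) _ = pair P.refl
    agree (inside  ∷ inside  ∷ inside  ∷ outside ∷ []) _ = via-B ⁅ # 2 ⁆ (pair P.refl)
    agree (inside  ∷ inside  ∷ outside ∷ inside  ∷ []) _ = e₀₁₃
    agree (inside  ∷ outside ∷ inside  ∷ inside  ∷ []) _ = e₀₂₃
    agree (outside ∷ inside  ∷ inside  ∷ inside  ∷ []) _ =
      via-A (# 0) (# 2) ⁅ # 1 ⁆ ⁅ # 3 ⁆ (⁅ # 1 ⁆ ∪ ⁅ # 3 ⁆) P.refl P.refl P.refl P.refl e₀₁₃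
    agree (inside  ∷ inside  ∷ inside  ∷ inside  ∷ []) _ = via-B (⁅ # 2 ⁆ ∪ ⁅ # 3 ⁆) e₀₂₃
    agree (inside  ∷ outside ∷ outside ∷ outside ∷ []) (s≤s ())
    agree (outside ∷ inside  ∷ outside ∷ outside ∷ []) (s≤s ())
    agree (outside ∷ outside ∷ inside  ∷ outside ∷ []) (s≤s ())
    agree (outside ∷ outside ∷ outside ∷ inside  ∷ []) (s≤s ())
    agree (outside ∷ outside ∷ outside ∷ outside ∷ []) ()

-- The converse: a family satisfying the conditions is realised by the
-- quartet tree whose pendant edges carry the weights a_i of (B) and whose
-- inner edge carries D_{02} − a_0 − a_2.

module Realisation {c ℓ} (R : CommutativeRing c ℓ) (half : Half R) (D : Subset 4 → CommutativeRing.Carrier R)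
                   (pseudo-cherry₁ : PseudoCherry R D (P12 R)) (A-D : CondA R D) (B-D : CondB R D half) where
  open CommutativeRing R renaming (Carrier to A)
  open RingFacts R
  open Halving (proj₁ half) (proj₂ half)
  open IntegerCoefficients R using (solve; _:+_; _:-_; _:=_; con)
  open Relation.Binary.Reasoning.Setoid setoid
  open TreeMetric R using (treeMetric; realises-treeMetric; realised-by-treeMetric)
  open QuartetTree using (quartet; cherry₀₁)

  d₀₁ d₀₂ d₀₃ d₁₂ d₁₃ d₂₃ : A
  d₀₁ = D (inside ∷ inside ∷ outside ∷ outside ∷ [])
  d₀₂ = D (inside ∷ outside ∷ inside ∷ outside ∷ [])
  d₀₃ = D (inside ∷ outside ∷ outside ∷ inside ∷ [])
  d₁₂ = D (outside ∷ inside ∷ inside ∷ outside ∷ [])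
  d₁₃ = D (outside ∷ inside ∷ outside ∷ inside ∷ [])
  d₂₃ = D (outside ∷ outside ∷ inside ∷ inside ∷ [])

  a₀ a₁ a₂ a₃ : A
  a₀ = aOf R D half (# 0) (# 1) ⁅ # 2 ⁆
  a₁ = aOf R D half (# 1) (# 0) ⁅ # 2 ⁆
  a₂ = aOf R D half (# 2) (# 3) ⁅ # 0 ⁆
  a₃ = aOf R D half (# 3) (# 2) ⁅ # 0 ⁆

  -- pendant edges carry the a_i; the inner weight makes the path from 0 to 2 weigh D_{02}
  weights : Fin 5 → A
  weights zero                         = a₀
  weights (suc zero)                   = a₁
  weights (suc (suc zero))             = a₂
  weights (suc (suc (suc zero)))       = a₃
  weights (suc (suc (suc (suc zero)))) = d₀₂ − a₀ − a₂

  Q : WTree R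
  Q = quartet R weights

  dQ : Subset 4 → A
  dQ = treeMetric Q

  star : d₁₃ − d₀₃ ≈ d₁₂ − d₀₂
  star = pseudo-cherry₁ (# 1) (# 0) (Vec.there Vec.here) Vec.here ⁅ # 3 ⁆ ⁅ # 2 ⁆
           (# 3 , Vec.there (Vec.there (Vec.there Vec.here))) (# 2 , Vec.there (Vec.there Vec.here))
           (λ { (Vec.there ()) }) (λ ()) (λ { (Vec.there ()) }) (λ ())

  pair₀₁ : dQ (inside ∷ inside ∷ outside ∷ outside ∷ []) ≈ d₀₁
  pair₀₁ = begin
    a₀ + (a₁ + (0# + (0# + (0# + 0#))))
      ≈⟨ solve 2 (λ a₀ a₁ → a₀ :+ (a₁ :+ (con (+ 0) :+ (con (+ 0) :+ (con (+ 0) :+ con (+ 0))))) := a₀ :+ a₁) refl a₀ a₁ ⟩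
    a₀ + a₁    ≈⟨ recombine d₀₁ d₀₂ d₁₂ ⟩
    d₀₁        ∎

  pair₂₃ : dQ (outside ∷ outside ∷ inside ∷ inside ∷ []) ≈ d₂₃
  pair₂₃ = begin
    0# + (0# + (a₂ + (a₃ + (0# + 0#))))
      ≈⟨ solve 2 (λ a₂ a₃ → con (+ 0) :+ (con (+ 0) :+ (a₂ :+ (a₃ :+ (con (+ 0) :+ con (+ 0))))) := a₂ :+ a₃) refl a₂ a₃ ⟩
    a₂ + a₃    ≈⟨ recombine d₂₃ d₀₂ d₀₃ ⟩
    d₂₃        ∎

  pair₀₂ : dQ (inside ∷ outside ∷ inside ∷ outside ∷ []) ≈ d₀₂
  pair₀₂ = solve 3 (λ a₀ a₂ d → a₀ :+ (con (+ 0) :+ (a₂ :+ (con (+ 0) :+ ((d :- a₀ :- a₂) :+ con (+ 0))))) := d)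
             refl a₀ a₂ d₀₂

  pair₀₃ : dQ (inside ∷ outside ∷ outside ∷ inside ∷ []) ≈ d₀₃
  pair₀₃ = begin
    a₀ + (0# + (0# + (a₃ + ((d₀₂ − a₀ − a₂) + 0#))))
      ≈⟨ solve 4 (λ a₀ a₂ a₃ d → a₀ :+ (con (+ 0) :+ (con (+ 0) :+ (a₃ :+ ((d :- a₀ :- a₂) :+ con (+ 0)))))
                                 := d :+ (a₃ :- a₂)) refl a₀ a₂ a₃ d₀₂ ⟩
    d₀₂ + (a₃ − a₂)     ≈⟨ +-congˡ (separate d₂₃ d₀₂ d₀₃) ⟩
    d₀₂ + (d₀₃ − d₀₂)   ≈⟨ solve 2 (λ d₀₂ d₀₃ → d₀₂ :+ (d₀₃ :- d₀₂) := d₀₃) refl d₀₂ d₀₃ ⟩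
    d₀₃                 ∎

  pair₁₂ : dQ (outside ∷ inside ∷ inside ∷ outside ∷ []) ≈ d₁₂
  pair₁₂ = begin
    0# + (a₁ + (a₂ + (0# + ((d₀₂ − a₀ − a₂) + 0#))))
      ≈⟨ solve 4 (λ a₀ a₁ a₂ d → con (+ 0) :+ (a₁ :+ (a₂ :+ (con (+ 0) :+ ((d :- a₀ :- a₂) :+ con (+ 0)))))
                                 := d :+ (a₁ :- a₀)) refl a₀ a₁ a₂ d₀₂ ⟩
    d₀₂ + (a₁ − a₀)     ≈⟨ +-congˡ (separate d₀₁ d₀₂ d₁₂) ⟩
    d₀₂ + (d₁₂ − d₀₂)   ≈⟨ solve 2 (λ d₀₂ d₁₂ → d₀₂ :+ (d₁₂ :- d₀₂) := d₁₂) refl d₀₂ d₁₂ ⟩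
    d₁₂                 ∎

  -- the only pair needing the pseudocherry condition
  pair₁₃ : dQ (outside ∷ inside ∷ outside ∷ inside ∷ []) ≈ d₁₃
  pair₁₃ = begin
    0# + (a₁ + (0# + (a₃ + ((d₀₂ − a₀ − a₂) + 0#))))
      ≈⟨ solve 5 (λ a₀ a₁ a₂ a₃ d → con (+ 0) :+ (a₁ :+ (con (+ 0) :+ (a₃ :+ ((d :- a₀ :- a₂) :+ con (+ 0)))))
                                    := d :+ (a₁ :- a₀) :+ (a₃ :- a₂)) refl a₀ a₁ a₂ a₃ d₀₂ ⟩
    d₀₂ + (a₁ − a₀) + (a₃ − a₂)       ≈⟨ +-cong (+-congˡ (separate d₀₁ d₀₂ d₁₂)) (separate d₂₃ d₀₂ d₀₃) ⟩
    d₀₂ + (d₁₂ − d₀₂) + (d₀₃ − d₀₂)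
      ≈⟨ solve 3 (λ d₀₂ d₀₃ d₁₂ → d₀₂ :+ (d₁₂ :- d₀₂) :+ (d₀₃ :- d₀₂) := (d₁₂ :- d₀₂) :+ d₀₃) refl d₀₂ d₀₃ d₁₂ ⟩
    (d₁₂ − d₀₂) + d₀₃                  ≈⟨ +-congʳ star ⟨
    (d₁₃ − d₀₃) + d₀₃                  ≈⟨ solve 2 (λ d₀₃ d₁₃ → (d₁₃ :- d₀₃) :+ d₀₃ := d₁₃) refl d₀₃ d₁₃ ⟩
    d₁₃                                ∎

  pairs : ∀ I → ∣ I ∣ ≡ 2 → dQ I ≈ D I
  pairs (inside  ∷ inside  ∷ outside ∷ outside ∷ []) _ = pair₀₁
  pairs (inside  ∷ outside ∷ inside  ∷ outside ∷ []) _ = pair₀₂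
  pairs (inside  ∷ outside ∷ outside ∷ inside  ∷ []) _ = pair₀₃
  pairs (outside ∷ inside  ∷ inside  ∷ outside ∷ []) _ = pair₁₂
  pairs (outside ∷ inside  ∷ outside ∷ inside  ∷ []) _ = pair₁₃
  pairs (outside ∷ outside ∷ inside  ∷ inside  ∷ []) _ = pair₂₃
  pairs (outside ∷ outside ∷ outside ∷ outside ∷ []) ()
  pairs (inside  ∷ outside ∷ outside ∷ outside ∷ []) ()
  pairs (outside ∷ inside  ∷ outside ∷ outside ∷ []) ()
  pairs (outside ∷ outside ∷ inside  ∷ outside ∷ []) ()
  pairs (outside ∷ outside ∷ outside ∷ inside  ∷ []) ()
  pairs (inside  ∷ inside  ∷ inside  ∷ outside ∷ []) ()
  pairs (inside  ∷ inside  ∷ outside ∷ inside  ∷ []) ()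
  pairs (inside  ∷ outside ∷ inside  ∷ inside  ∷ []) ()
  pairs (outside ∷ inside  ∷ inside  ∷ inside  ∷ []) ()
  pairs (inside  ∷ inside  ∷ inside  ∷ inside  ∷ []) ()

  -- Q satisfies (A) and (B), like every tree with the cherry {0,1} ...
  Q-tree-like : TreeIdentities.TreeLike R dQ
  Q-tree-like = TreeIdentities.realised-treeLike R Q (cherry₀₁ R weights) (realises-treeMetric Q)

  A-dQ : CondA R dQ
  A-dQ = Conditions.condition-A R dQ Q-tree-like

  B-dQ : CondB R dQ half
  B-dQ = Conditions.condition-B R dQ Q-tree-like half

  -- ... so it agrees with D everywhere
  realises : Realises R Q D
  realises = realised-by-treeMetric Q (Determination.agree R half dQ D A-dQ B-dQ A-D B-D pairs)

lemma3p2 : ∀ {c ℓ} (R : CommutativeRing c ℓ) (h : Half R)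
    (D : Subset 4 → CommutativeRing.Carrier R) →
    (Σ (WTree R) λ T → IsCherry R T (# 0) (# 1) × IsCherry R T (# 2) (# 3) × Realises R T D)
    ⇔ (PseudoCherry R D (P12 R) × PseudoCherry R D (P34 R) × CondA R D × CondB R D h)
lemma3p2 R h D = mk⇔ tree⇒conditions conditions⇒tree
  where
  tree⇒conditions : Σ (WTree R) (λ T → IsCherry R T (# 0) (# 1) × IsCherry R T (# 2) (# 3) × Realises R T D) →
    PseudoCherry R D (P12 R) × PseudoCherry R D (P34 R) × CondA R D × CondB R D h
  tree⇒conditions (T , cherry , _ , real) =
    pseudo-cherry (P12 R) star-certificates₁ , pseudo-cherry (P34 R) star-certificates₂ ,
    condition-A , condition-B h
    where open Conditions R D (TreeIdentities.realised-treeLike R T cherry real)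

  conditions⇒tree : PseudoCherry R D (P12 R) × PseudoCherry R D (P34 R) × CondA R D × CondB R D h →
    Σ (WTree R) (λ T → IsCherry R T (# 0) (# 1) × IsCherry R T (# 2) (# 3) × Realises R T D)
  conditions⇒tree (pseudo-cherry₁ , _ , A-D , B-D) =
    Q , QuartetTree.cherry₀₁ R weights , QuartetTree.cherry₂₃ R weights , realises
    where open Realisation R h D pseudo-cherry₁ A-D B-D
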